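{- Let $K$ be an imaginary quadratic field with discriminant $\Delta$ and ring of integers $\mathcal{O}_K$, and let $\Lambda\subseteq\mathcal{O}_K$ be a rank two $\mathbb{Z}$-lattice. The following are equivalent: (1) $\Lambda$ has a $\mathbb{Z}$-basis $\beta,\delta$ consisting of coprime elements (i.e. $(\beta)+(\delta)=\mathcal{O}_K$); (2) the conductor of $\Lambda$ equals its covolume $[\mathcal{O}_K:\Lambda]$. Furthermore, for each positive integer $f$, an ideal class $[\mathfrak a]\in\mathcal{P}ic(\mathcal{O}_f)$ lies in $\ker\theta_f$ if and only if it has a representative lattice $\Lambda\subseteq\mathcal{O}_K$ satisfying these conditions, and in that case such a $\Lambda$ is unique up to multiplication by a unit of $\mathcal{O}_K$. Further, if $\beta,\delta$ form a $\mathbb{Z}$-basis of $\Lambda$, then $[\mathcal{O}_K:\Lambda]=\frac{1}{\sqrt{ -\Delta}}\,|\overline{\beta}\delta-\beta\overline{\delta}|$.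
   Context: For a positive integer $f$, $\mathcal{O}_f=\mathbb{Z}+f\mathcal{O}_K$ is the order of conductor $f$; $\mathcal{P}ic(\mathcal{O}_f)$ is the group of invertible fractional ideals of $\mathcal{O}_f$ modulo principal ones, and $\theta_f:\mathcal{P}ic(\mathcal{O}_f)\to\mathcal{P}ic(\mathcal{O}_K)$ is $[\mathfrak a]\mapsto[\mathfrak a\mathcal{O}_K]$. The order of a rank two lattice $\Lambda\subseteq\mathcal{O}_K$ is $\mathrm{Ord}(\Lambda)=\{\alpha\in\mathcal{O}_K:\alpha\Lambda\subseteq\Lambda\}$, an order of $K$; the conductor of $\Lambda$ is the conductor of $\mathrm{Ord}(\Lambda)$, and $\Lambda$ is a fractional ideal of $\mathrm{Ord}(\Lambda)$. A representative lattice of a class $[\mathfrak a]\in\mathcal{P}ic(\mathcal{O}_f)$ is a lattice $\Lambda\subseteq\mathcal{O}_K$ that is a fractional $\mathcal{O}_f$-ideal in that class. The covolume of $\Lambda$ is the index $[\mathcal{O}_K:\Lambda]$. -}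

module Defs where

open import Data.Nat as ℕ using (ℕ; zero; suc)
open import Data.Integer as ℤ using (ℤ; +_; -_; _+_; _*_; _-_; _/_; ∣_∣)
open import Data.Integer.Divisibility as ℤD using ()
open import Data.Fin using (Fin; zero; suc)
open import Data.Product using (Σ; ∃; ∃-syntax; _×_; _,_)
open import Data.Sum using (_⊎_)
open import Data.Unit using (⊤)
open import Relation.Nullary using (¬_)
open import Relation.Binary.PropositionalEquality using (_≡_)
open import Function.Bundles using (_⇔_)

SquarefreeNat : ℕ → Set
SquarefreeNat m = ∀ p → (p ℕ.* p) Data.Nat.Divisibility.∣ m → p ≡ 1
  where import Data.Nat.Divisibility

ImagQuadDisc : ℤ → Set
ImagQuadDisc Δ =
  (Δ ℤ.< + 0) ×
  ( ((ℤD._∣_ (+ 4) (Δ - + 1)) × SquarefreeNat ∣ Δ ∣)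
  ⊎ (∃[ m ] (Δ ≡ + 4 * m) ×
       ((ℤD._∣_ (+ 4) (m - + 2)) ⊎ (ℤD._∣_ (+ 4) (m - + 3))) ×
       SquarefreeNat ∣ m ∣) )

-- The ring of integers O_K = ℤ[ω], ω = (Δ + √Δ)/2, which satisfies
--   ω² = Δ ω + (Δ - Δ²)/4 ,   ω̄ = Δ - ω ,   ω - ω̄ = √Δ.
-- The pair (a , b) represents a + b ω (representation is unique).

OK : Set
OK = ℤ × ℤ

zeroK oneK ω : OK
zeroK = (+ 0 , + 0)
oneK  = (+ 1 , + 0)
ω     = (+ 0 , + 1)

_⊕_ : OK → OK → OK
(a , b) ⊕ (c , d) = (a + c , b + d)

⊖_ : OK → OK
⊖ (a , b) = (- a , - b)

_⊝_ : OK → OK → OK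
x ⊝ y = x ⊕ (⊖ y)

_·_ : ℤ → OK → OK
m · (a , b) = (m * a , m * b)

module _ (Δ : ℤ) where

  -- constant term: ω² = Δ ω + tK
  tK : ℤ
  tK = (Δ - Δ * Δ) / (+ 4)

  mulK : OK → OK → OK
  mulK (a , b) (c , d) = (a * c + b * d * tK , a * d + b * c + b * d * Δ)

  -- Galois conjugation: a + b ω ↦ a + b ω̄ = (a + b Δ) - b ω
  conjK : OK → OK
  conjK (a , b) = (a + b * Δ , - b)

  IsBasis : (OK → Set) → OK → OK → Set
  IsBasis Λ β δ =
    (∀ m n → (m · β) ⊕ (n · δ) ≡ zeroK → (m ≡ + 0) × (n ≡ + 0)) ×
    (∀ x → Λ x ⇔ (∃[ m ] ∃[ n ] x ≡ (m · β) ⊕ (n · δ)))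

  IsLattice : (OK → Set) → Set
  IsLattice Λ = ∃[ β ] ∃[ δ ] IsBasis Λ β δ

  -- [O_K : Λ] = n : there is a complete, irredundant system of
  -- n representatives of O_K / Λ.
  Index : (OK → Set) → ℕ → Set
  Index Λ n = Σ (Fin n → OK) λ r →
    (∀ i j → Λ (r i ⊝ r j) → i ≡ j) ×
    (∀ x → ∃[ i ] Λ (x ⊝ r i))

  -- membership in the order O_f = ℤ + f O_K = { a + b ω : f ∣ b }
  InOrder : ℕ → OK → Set
  InOrder f (a , b) = ℤD._∣_ (+ f) b

  Ord : (OK → Set) → OK → Set
  Ord Λ α = ∀ x → Λ x → Λ (mulK α x)

  Conductor : (OK → Set) → ℕ → Set
  Conductor Λ f = (1 ℕ.≤ f) × (∀ α → Ord Λ α ⇔ InOrder f α)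

  sumK : (k : ℕ) → (Fin k → OK) → OK
  sumK zero    v = zeroK
  sumK (suc k) v = v zero ⊕ sumK k (λ i → v (suc i))

  InProd : (OK → Set) → (OK → Set) → OK → Set
  InProd A B x = ∃[ k ] Σ (Fin k → OK) λ as → Σ (Fin k → OK) λ bs →
    (∀ i → A (as i)) × (∀ i → B (bs i)) ×
    (x ≡ sumK k (λ i → mulK (as i) (bs i)))

  IsOfModule : ℕ → (OK → Set) → Set
  IsOfModule f A = ∀ α x → InOrder f α → A x → A (mulK α x)

  -- A is invertible as an O_f-ideal: there is a fractional O_f-ideal
  -- (1/d) B (B ⊆ O_K a lattice, d ≠ 0) with A · (1/d) B = O_f,
  -- i.e. A B = d O_f.
  Invertible : ℕ → (OK → Set) → Set₁
  Invertible f A = ∃[ B ] ∃[ d ] ¬ (d ≡ + 0) × IsLattice B × IsOfModule f B ×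
    (∀ x → InProd A B x ⇔ (∃[ y ] InOrder f y × (x ≡ d · y)))

  -- invertible (fractional) O_f-ideal, represented by a lattice in O_K
  InvIdeal : ℕ → (OK → Set) → Set₁
  InvIdeal f A = IsLattice A × IsOfModule f A × Invertible f A

  Scaled : OK → (OK → Set) → OK → Set
  Scaled α A x = ∃[ y ] A y × (x ≡ mulK α y)

  -- A and B define the same class: B = λ A for some λ = α/β ∈ K*
  SameClass : (OK → Set) → (OK → Set) → Set
  SameClass A B = ∃[ α ] ∃[ β ] ¬ (α ≡ zeroK) × ¬ (β ≡ zeroK) ×
    (∀ x → Scaled α A x ⇔ Scaled β B x)

  -- [A] ∈ ker θ_f : A O_K is a principal ideal γ O_K of O_K
  InKer : (OK → Set) → Set
  InKer A = ∃[ γ ] ¬ (γ ≡ zeroK) ×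
    (∀ x → InProd A (λ _ → ⊤) x ⇔ Scaled γ (λ _ → ⊤) x)

  RepLattice : ℕ → (OK → Set) → (OK → Set) → Set
  RepLattice f A Λ = IsLattice Λ × IsOfModule f Λ × SameClass Λ A

  Coprime : OK → OK → Set
  Coprime β δ = ∃[ x ] ∃[ y ] (mulK x β ⊕ mulK y δ) ≡ oneK

  Cond1 : (OK → Set) → Set
  Cond1 Λ = ∃[ β ] ∃[ δ ] IsBasis Λ β δ × Coprime β δ

  Cond2 : (OK → Set) → Set
  Cond2 Λ = ∃[ n ] Conductor Λ n × Index Λ n

  IsUnit : OK → Set
  IsUnit u = ∃[ v ] mulK u v ≡ oneK

  sqrtΔ : OK
  sqrtΔ = ω ⊝ conjK ω

-- Every lattice Λ ⊆ O_K has a Hermite basis e₁ = a, e₂ = b + cω with a, c > 0, so its covolume is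
-- ac = |det|, and x + yω stabilises Λ iff c ∣ ya, c ∣ yb and ac ∣ y N(e₂). If 1 = X e₁ + Z e₂,
-- taking norms shows that these conditions force ac ∣ y, so the conductor is ac. Conversely, if the
-- conductor is ac, then y = ac/d with d = gcd(ac, a², ab, N(e₂)) satisfies them, so d = 1 and
-- Bézout gives 1 = X e₁ + Z ē₂ e₂. For the kernel: if A O_K = γ O_K then γ⁻¹A ⊆ O_K is a
-- representative with a coprime basis; conversely, if αΛ = α′A and Λ contains coprime β, δ, then α′
-- divides αβ and αδ, hence α, so A = γΛ with γ ∈ O_K and A O_K = γ Λ O_K = γ O_K. Two such γ divide
-- each other, which gives uniqueness up to a unit. Finally β̄δ − βδ̄ = det(β, δ) √Δ.

module Submission where

open import Defs
open import Data.Nat as ℕ using (ℕ; zero; suc; _≤_)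
import Data.Nat.Properties as ℕP
import Data.Nat.DivMod as ℕDM
import Data.Nat.Divisibility as ℕD
import Data.Nat.GCD as ℕGCD
open import Data.Integer as ℤ using (ℤ; +_; -_; _+_; _*_; _-_; ∣_∣; 0ℤ; 1ℤ; -1ℤ; -[1+_]; +[1+_])
import Data.Integer.Properties as ℤP
import Data.Integer.DivMod as ℤDM
open import Data.Integer.Divisibility.Signed
open import Data.Integer.Tactic.RingSolver using (solve-∀)
open import Data.Fin using (Fin; zero; suc; toℕ; fromℕ<; remQuot; combine)
import Data.Fin.Properties as FinP
open import Data.Product using (∃; ∃-syntax; _×_; _,_; proj₁; proj₂; uncurry)
open import Data.Sum as Sum using (_⊎_; inj₁; inj₂)
open import Data.Unit using (⊤; tt)
open import Relation.Nullary using (¬_)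
open import Relation.Binary.PropositionalEquality
open import Function.Bundles using (_⇔_; mk⇔; Equivalence)

%-injective : ∀ {x y C} .{{_ : ℕ.NonZero C}} → x ℕ.< C → y ℕ.< C →
              ∀ k → x ≡ y ℕ.+ k ℕ.* C → x ≡ y
%-injective {x} {y} {C} x<C y<C k eq = begin
  x                     ≡⟨ ℕDM.m<n⇒m%n≡m x<C ⟨
  x ℕ.% C               ≡⟨ cong (ℕ._% C) eq ⟩
  (y ℕ.+ k ℕ.* C) ℕ.% C ≡⟨ ℕDM.[m+kn]%n≡m%n y k C ⟩
  y ℕ.% C               ≡⟨ ℕDM.m<n⇒m%n≡m y<C ⟩
  y                     ∎
  where open ≡-Reasoning

pos-+-* : ∀ y k C → + y + + k * + C ≡ + (y ℕ.+ k ℕ.* C)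
pos-+-* y k C = trans (cong (_+_ (+ y)) (sym (ℤP.pos-* k C))) (sym (ℤP.pos-+ y (k ℕ.* C)))

residue-unique : ∀ {x y C} .{{_ : ℕ.NonZero C}} → x ℕ.< C → y ℕ.< C →
                 ∀ n → + x ≡ + y + n * + C → x ≡ y
residue-unique {x} {y} {C} x<C y<C (+ k) eq =
  %-injective x<C y<C k (ℤP.+-injective (trans eq (pos-+-* y k C)))
residue-unique {x} {y} {C} x<C y<C -[1+ k ] eq =
  sym (%-injective y<C x<C (suc k) (ℤP.+-injective (trans swapped (pos-+-* x (suc k) C))))
  where
  move : ∀ x y n C → x ≡ y + (- n) * C → y ≡ x + n * C
  move x y n C eq = trans (l y n C) (cong (_+ n * C) (sym eq))
    where
    l : ∀ y n C → y ≡ y + (- n) * C + n * C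
    l = solve-∀
  swapped : + y ≡ + x + + suc k * + C
  swapped = move (+ x) (+ y) (+ suc k) (+ C) eq

n*[i/n]≡i : ∀ i n .{{_ : ℕ.NonZero n}} → + n ∣ i → + n * (i ℤ./ + n) ≡ i
n*[i/n]≡i i n (divides q i≡qn) = begin
  + n * (i ℤ./ + n)               ≡⟨ ℤP.*-comm (+ n) _ ⟩
  (i ℤ./ + n) * + n               ≡⟨ ℤP.+-identityˡ _ ⟨
  + 0 + (i ℤ./ + n) * + n         ≡⟨ cong (λ r → + r + (i ℤ./ + n) * + n) remainder≡0 ⟨
  + (i ℤ.% + n) + (i ℤ./ + n) * + n ≡⟨ ℤDM.a≡a%n+[a/n]*n i (+ n) ⟨
  i                               ∎
  where
  open ≡-Reasoning
  rearrange : ∀ r i q′ q n → i ≡ r + q′ * n → i ≡ q * n → r ≡ + 0 + (q - q′) * n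
  rearrange r i q′ q n e₁ e₂ =
    trans (l r q′ n) (trans (cong (_- q′ * n) (trans (sym e₁) e₂)) (m q q′ n))
    where
    l : ∀ r q′ n → r ≡ (r + q′ * n) - q′ * n
    l = solve-∀
    m : ∀ q q′ n → q * n - q′ * n ≡ + 0 + (q - q′) * n
    m = solve-∀
  remainder≡0 : i ℤ.% + n ≡ 0
  remainder≡0 = residue-unique (ℤDM.n%d<d i (+ n)) (ℕ.>-nonZero⁻¹ n) (q - i ℤ./ + n)
    (rearrange _ i _ q (+ n) (ℤDM.a≡a%n+[a/n]*n i (+ n)) i≡qn)

sign-factor : ∀ i → ∃[ σ ] (+ ∣ i ∣ ≡ σ * i) × (σ * σ ≡ 1ℤ)
sign-factor i with ℤP.+∣i∣≡i⊎+∣i∣≡-i i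
... | inj₁ e = 1ℤ , trans e (sym (ℤP.*-identityˡ i)) , refl
... | inj₂ e = -1ℤ , trans e (sym (ℤP.-1*i≡-i i)) , refl

bezout : ∀ i j → ∃[ d ] (+ d ∣ i) × (+ d ∣ j) × ∃[ u ] ∃[ v ] + d ≡ u * i + v * j
bezout i j with ℕGCD.Bézout.lemma ∣ i ∣ ∣ j ∣
... | ℕGCD.Bézout.result d gcd identity =
  d , ∣ᵤ⇒∣ (proj₁ (ℕGCD.GCD.commonDivisor gcd)) , ∣ᵤ⇒∣ (proj₂ (ℕGCD.GCD.commonDivisor gcd)) ,
  combination identity
  where
  σ τ : ℤ
  σ = proj₁ (sign-factor i)
  τ = proj₁ (sign-factor j)
  ∣i∣≡σi : + ∣ i ∣ ≡ σ * i
  ∣i∣≡σi = proj₁ (proj₂ (sign-factor i))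
  ∣j∣≡τj : + ∣ j ∣ ≡ τ * j
  ∣j∣≡τj = proj₁ (proj₂ (sign-factor j))
  lift : ∀ a A b B → d ℕ.+ b ℕ.* B ≡ a ℕ.* A → + d ≡ + a * + A - + b * + B
  lift a A b B e = trans (l (+ d) (+ b * + B))
    (cong (_- + b * + B) (trans (pos-+-* d b B) (trans (cong +_ e) (ℤP.pos-* a A))))
    where
    l : ∀ d x → d ≡ (d + x) - x
    l = solve-∀
  combination : ℕGCD.Bézout.Identity d ∣ i ∣ ∣ j ∣ → ∃[ u ] ∃[ v ] + d ≡ u * i + v * j
  combination (ℕGCD.Bézout.+- a b e) = + a * σ , - (+ b * τ) ,
    trans (lift a (∣ i ∣) b (∣ j ∣) e)
      (trans (cong₂ (λ I J → + a * I - + b * J) ∣i∣≡σi ∣j∣≡τj) (l (+ a) σ i (+ b) τ j))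
    where
    l : ∀ a σ i b τ j → a * (σ * i) - b * (τ * j) ≡ a * σ * i + (- (b * τ)) * j
    l = solve-∀
  combination (ℕGCD.Bézout.-+ a b e) = - (+ a * σ) , + b * τ ,
    trans (lift b (∣ j ∣) a (∣ i ∣) e)
      (trans (cong₂ (λ J I → + b * J - + a * I) ∣j∣≡τj ∣i∣≡σi) (l (+ a) σ i (+ b) τ j))
    where
    l : ∀ a σ i b τ j → b * (τ * j) - a * (σ * i) ≡ (- (a * σ)) * i + b * τ * j
    l = solve-∀

bezout₄ : ∀ i j k l → ∃[ d ] (+ d ∣ i) × (+ d ∣ j) × (+ d ∣ k) × (+ d ∣ l) ×
          ∃[ c₁ ] ∃[ c₂ ] ∃[ c₃ ] ∃[ c₄ ] + d ≡ c₁ * i + c₂ * j + c₃ * k + c₄ * l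
bezout₄ i j k l with bezout i j
... | d₁ , d₁∣i , d₁∣j , u₁ , v₁ , e₁ with bezout (+ d₁) k
... | d₂ , d₂∣d₁ , d₂∣k , u₂ , v₂ , e₂ with bezout (+ d₂) l
... | d₃ , d₃∣d₂ , d₃∣l , u₃ , v₃ , e₃ =
  d₃ , ∣-trans d₃∣d₁ d₁∣i , ∣-trans d₃∣d₁ d₁∣j , ∣-trans d₃∣d₂ d₂∣k , d₃∣l ,
  u₃ * u₂ * u₁ , u₃ * u₂ * v₁ , u₃ * v₂ , v₃ ,
  trans e₃ (trans (cong (λ z → u₃ * z + v₃ * l) (trans e₂ (cong (λ z → u₂ * z + v₂ * k) e₁)))
    (expand u₁ u₂ u₃ v₁ v₂ v₃ i j k l))
  where
  d₃∣d₁ : + d₃ ∣ + d₁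
  d₃∣d₁ = ∣-trans d₃∣d₂ d₂∣d₁
  expand : ∀ u₁ u₂ u₃ v₁ v₂ v₃ i j k l →
    u₃ * (u₂ * (u₁ * i + v₁ * j) + v₂ * k) + v₃ * l
    ≡ u₃ * u₂ * u₁ * i + u₃ * u₂ * v₁ * j + u₃ * v₂ * k + v₃ * l
  expand = solve-∀

i*i≡+∣i∣*∣i∣ : ∀ i → i * i ≡ + (∣ i ∣ ℕ.* ∣ i ∣)
i*i≡+∣i∣*∣i∣ (+ n)    = sym (ℤP.pos-* n n)
i*i≡+∣i∣*∣i∣ -[1+ n ] = refl

n*n≡0⇒n≡0 : ∀ n → n ℕ.* n ≡ 0 → n ≡ 0
n*n≡0⇒n≡0 zero _ = refl

i*i+j*j*[1+k]≡0⇒i≡0×j≡0 : ∀ i j k → i * i + j * j * + suc k ≡ 0ℤ → i ≡ 0ℤ × j ≡ 0ℤ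
i*i+j*j*[1+k]≡0⇒i≡0×j≡0 i j k e =
  ℤP.∣i∣≡0⇒i≡0 (n*n≡0⇒n≡0 ∣ i ∣ (ℕP.m+n≡0⇒m≡0 ∣i∣² inℕ)) ,
  ℤP.∣i∣≡0⇒i≡0 (n*n≡0⇒n≡0 ∣ j ∣ (ℕP.m*n≡0⇒m≡0 ∣j∣² (suc k) (ℕP.m+n≡0⇒n≡0 ∣i∣² inℕ)))
  where
  ∣i∣² ∣j∣² : ℕ
  ∣i∣² = ∣ i ∣ ℕ.* ∣ i ∣
  ∣j∣² = ∣ j ∣ ℕ.* ∣ j ∣
  inℕ : ∣i∣² ℕ.+ ∣j∣² ℕ.* suc k ≡ 0
  inℕ = ℤP.+-injective (begin
    + (∣i∣² ℕ.+ ∣j∣² ℕ.* suc k)      ≡⟨ ℤP.pos-+ ∣i∣² (∣j∣² ℕ.* suc k) ⟩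
    + ∣i∣² + + (∣j∣² ℕ.* suc k)      ≡⟨ cong (_+_ (+ ∣i∣²)) (ℤP.pos-* ∣j∣² (suc k)) ⟩
    + ∣i∣² + + ∣j∣² * + suc k        ≡⟨ cong₂ (λ x y → x + y * + suc k) (i*i≡+∣i∣*∣i∣ i) (i*i≡+∣i∣*∣i∣ j) ⟨
    i * i + j * j * + suc k          ≡⟨ e ⟩
    0ℤ                               ∎)
    where open ≡-Reasoning

i*j≡0⇒i≡0 : ∀ i j .{{_ : ℤ.NonZero j}} → i * j ≡ 0ℤ → i ≡ 0ℤ
i*j≡0⇒i≡0 i j eq = ℤP.*-cancelʳ-≡ i 0ℤ j (trans eq (sym (ℤP.*-zeroˡ j)))

i<0⇒-i≡+[1+k] : ∀ {i} → i ℤ.< 0ℤ → ∃[ k ] - i ≡ +[1+ k ]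
i<0⇒-i≡+[1+k] { -[1+ k ]} _ = k , refl
i<0⇒-i≡+[1+k] {+ n} (ℤ.+<+ ())

x-y≡z⇒x≡y+z : ∀ x y {z} → x - y ≡ z → x ≡ y + z
x-y≡z⇒x≡y+z x y refl = l x y
  where
  l : ∀ x y → x ≡ y + (x - y)
  l = solve-∀

i≡±∣i∣ : ∀ i → i ≡ + ∣ i ∣ ⊎ i ≡ - + ∣ i ∣
i≡±∣i∣ (+ n)    = inj₁ refl
i≡±∣i∣ -[1+ n ] = inj₂ refl

LinearlyIndependent : OK → OK → Set
LinearlyIndependent β δ = ∀ m n → (m · β) ⊕ (n · δ) ≡ zeroK → (m ≡ 0ℤ) × (n ≡ 0ℤ)

Span : OK → OK → OK → Set
Span β δ x = ∃[ m ] ∃[ n ] x ≡ (m · β) ⊕ (n · δ)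

span-lincomb : ∀ {β δ x y} → Span β δ x → Span β δ y → ∀ p q → Span β δ ((p · x) ⊕ (q · y))
span-lincomb {b₁ , b₂} {d₁ , d₂} (m₁ , n₁ , refl) (m₂ , n₂ , refl) p q =
  p * m₁ + q * m₂ , p * n₁ + q * n₂ , cong₂ _,_ (l p q m₁ n₁ m₂ n₂ b₁ d₁) (l p q m₁ n₁ m₂ n₂ b₂ d₂)
  where
  l : ∀ p q m₁ n₁ m₂ n₂ b d →
      p * (m₁ * b + n₁ * d) + q * (m₂ * b + n₂ * d) ≡ (p * m₁ + q * m₂) * b + (p * n₁ + q * n₂) * d
  l = solve-∀

span-left : ∀ β δ → Span β δ β
span-left (b₁ , b₂) (d₁ , d₂) = 1ℤ , 0ℤ , cong₂ _,_ (l b₁ d₁) (l b₂ d₂)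
  where
  l : ∀ b d → b ≡ 1ℤ * b + 0ℤ * d
  l = solve-∀

span-right : ∀ β δ → Span β δ δ
span-right (b₁ , b₂) (d₁ , d₂) = 0ℤ , 1ℤ , cong₂ _,_ (l b₁ d₁) (l b₂ d₂)
  where
  l : ∀ b d → d ≡ 0ℤ * b + 1ℤ * d
  l = solve-∀

span-· : ∀ {β δ x} m → Span β δ x → Span β δ (m · x)
span-· {x = x₁ , x₂} m p = subst (Span _ _) (cong₂ _,_ (l m x₁) (l m x₂)) (span-lincomb p p m 0ℤ)
  where
  l : ∀ m x → m * x + 0ℤ * x ≡ m * x
  l = solve-∀

span-⊝ : ∀ {β δ x y} → Span β δ x → Span β δ y → Span β δ (x ⊝ y)
span-⊝ {x = x₁ , x₂} {y₁ , y₂} p q = subst (Span _ _) (cong₂ _,_ (l x₁ y₁) (l x₂ y₂)) (span-lincomb p q 1ℤ -1ℤ)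
  where
  l : ∀ x y → 1ℤ * x + -1ℤ * y ≡ x + - y
  l = solve-∀

span-⊆ : ∀ {β δ β′ δ′} → Span β′ δ′ β → Span β′ δ′ δ → ∀ {x} → Span β δ x → Span β′ δ′ x
span-⊆ pβ pδ (m , n , refl) = span-lincomb pβ pδ m n

⊝-⊝-cancelʳ : ∀ a b c → (a ⊝ b) ⊝ (c ⊝ b) ≡ a ⊝ c
⊝-⊝-cancelʳ (a₁ , a₂) (b₁ , b₂) (c₁ , c₂) = cong₂ _,_ (l a₁ b₁ c₁) (l a₂ b₂ c₂)
  where
  l : ∀ a b c → (a + - b) + - (c + - b) ≡ a + - c
  l = solve-∀

det : OK → OK → ℤ
det (p , q) (r , s) = p * s - q * r

_≐_ : (OK → Set) → (OK → Set) → Set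
A ≐ B = ∀ x → A x ⇔ B x

⊕-zeroʳ : ∀ x → x ⊕ zeroK ≡ x
⊕-zeroʳ (a , b) = cong₂ _,_ (ℤP.+-identityʳ a) (ℤP.+-identityʳ b)

⊕-interchange : ∀ a b c d → (a ⊕ b) ⊕ (c ⊕ d) ≡ (a ⊕ c) ⊕ (b ⊕ d)
⊕-interchange (a₁ , a₂) (b₁ , b₂) (c₁ , c₂) (d₁ , d₂) = cong₂ _,_ (l a₁ b₁ c₁ d₁) (l a₂ b₂ c₂ d₂)
  where
  l : ∀ a b c d → (a + b) + (c + d) ≡ (a + c) + (b + d)
  l = solve-∀

-- If det β δ = 0 then s β - q δ = 0 and -r β + p δ = 0, which forces β = 0.
independent⇒det≢0 : ∀ {β δ} → LinearlyIndependent β δ → det β δ ≢ 0ℤ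
independent⇒det≢0 {p , q} {r , s} indep det≡0 = 1≢0 (proj₁ (indep 1ℤ 0ℤ β≡0))
  where
  1≢0 : 1ℤ ≢ 0ℤ
  1≢0 ()
  l₁ : ∀ p q r s → s * p + (- q) * r ≡ p * s - q * r
  l₁ = solve-∀
  l₂ : ∀ q s → s * q + (- q) * s ≡ 0ℤ
  l₂ = solve-∀
  l₃ : ∀ p r → (- r) * p + p * r ≡ 0ℤ
  l₃ = solve-∀
  l₄ : ∀ p q r s → (- r) * q + p * s ≡ p * s - q * r
  l₄ = solve-∀
  s≡0×q≡0 : s ≡ 0ℤ × - q ≡ 0ℤ
  s≡0×q≡0 = indep s (- q) (cong₂ _,_ (trans (l₁ p q r s) det≡0) (l₂ q s))
  r≡0×p≡0 : - r ≡ 0ℤ × p ≡ 0ℤ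
  r≡0×p≡0 = indep (- r) p (cong₂ _,_ (l₃ p r) (trans (l₄ p q r s) det≡0))
  l₅ : ∀ p q r s → 1ℤ * p + 0ℤ * r ≡ p
  l₅ = solve-∀
  β≡0 : (1ℤ · (p , q)) ⊕ (0ℤ · (r , s)) ≡ zeroK
  β≡0 = cong₂ _,_ (trans (l₅ p q r s) (proj₂ r≡0×p≡0)) (trans (l₅ q p s r) (ℤP.neg-injective (proj₂ s≡0×q≡0)))

triangular-independent : ∀ a c .{{_ : ℕ.NonZero a}} .{{_ : ℕ.NonZero c}} b →
                         LinearlyIndependent (+ a , 0ℤ) (b , + c)
triangular-independent a c b m n eq = m≡0 , n≡0
  where
  l₁ : ∀ m n c → m * 0ℤ + n * c ≡ n * c
  l₁ = solve-∀
  n≡0 : n ≡ 0ℤ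
  n≡0 = i*j≡0⇒i≡0 n (+ c) (trans (sym (l₁ m n (+ c))) (cong proj₂ eq))
  l₂ : ∀ m a b → m * a + 0ℤ * b ≡ m * a
  l₂ = solve-∀
  m≡0 : m ≡ 0ℤ
  m≡0 = i*j≡0⇒i≡0 m (+ a)
    (trans (sym (l₂ m (+ a) b)) (trans (cong (λ z → m * + a + z * b) (sym n≡0)) (cong proj₁ eq)))

span-·-unit : ∀ {σ} x y → σ * σ ≡ 1ℤ → Span (σ · x) y x
span-·-unit {σ} (x₁ , x₂) (y₁ , y₂) σσ≡1 = σ , 0ℤ , cong₂ _,_ (l x₁ y₁) (l x₂ y₂)
  where
  m : ∀ σ x y → σ * σ * x ≡ σ * (σ * x) + 0ℤ * y
  m = solve-∀
  l : ∀ x y → x ≡ σ * (σ * x) + 0ℤ * y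
  l x y = trans (sym (ℤP.*-identityˡ x)) (trans (cong (_* x) (sym σσ≡1)) (m σ x y))

cofactors-coprime : ∀ {q s g q′ s′ u v} .{{_ : ℕ.NonZero g}} →
                    q ≡ q′ * + g → s ≡ s′ * + g → + g ≡ u * q + v * s → u * q′ + v * s′ ≡ 1ℤ
cofactors-coprime {q} {s} {g} {q′} {s′} {u} {v} q≡q′g s≡s′g g≡uq+vs = ℤP.*-cancelʳ-≡ _ _ (+ g) (begin
  (u * q′ + v * s′) * + g          ≡⟨ l u q′ v s′ (+ g) ⟩
  u * (q′ * + g) + v * (s′ * + g)  ≡⟨ cong₂ (λ q s → u * q + v * s) q≡q′g s≡s′g ⟨
  u * q + v * s                    ≡⟨ g≡uq+vs ⟨
  + g                              ≡⟨ ℤP.*-identityˡ (+ g) ⟨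
  1ℤ * + g                         ∎)
  where
  open ≡-Reasoning
  l : ∀ u q′ v s′ g → (u * q′ + v * s′) * g ≡ u * (q′ * g) + v * (s′ * g)
  l = solve-∀

-- The change of basis ((s′, -q′), (u, v)) has determinant uq′ + vs′ = 1.
gcd-triangular-basis : ∀ p r {q s g q′ s′ u v} →
  q ≡ q′ * + g → s ≡ s′ * + g → + g ≡ u * q + v * s → u * q′ + v * s′ ≡ 1ℤ →
  let e₁ = (s′ * p - q′ * r , 0ℤ); e₂ = (u * p + v * r , + g) in
  Span (p , q) (r , s) e₁ × Span (p , q) (r , s) e₂ × Span e₁ e₂ (p , q) × Span e₁ e₂ (r , s)
gcd-triangular-basis p r {q} {s} {g} {q′} {s′} {u} {v} q≡q′g s≡s′g g≡uq+vs unimodular =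
  (s′ , - q′ , cong₂ _,_ (l₁ s′ p q′ r)
                         (trans (l₂ s′ q′ (+ g)) (sym (cong₂ (λ q s → s′ * q + (- q′) * s) q≡q′g s≡s′g)))) ,
  (u , v , cong₂ _,_ refl g≡uq+vs) ,
  (v , q′ , cong₂ _,_ (trans (p≡p*1 p) (l₃ p q′ r s′ u v)) (trans q≡q′g (l₄ v q′ (+ g)))) ,
  (- u , s′ , cong₂ _,_ (trans (p≡p*1 r) (l₅ p q′ r s′ u v)) (trans s≡s′g (l₄ (- u) s′ (+ g))))
  where
  p≡p*1 : ∀ p → p ≡ p * (u * q′ + v * s′)
  p≡p*1 p = trans (sym (ℤP.*-identityʳ p)) (cong (p *_) (sym unimodular))
  l₁ : ∀ s′ p q′ r → s′ * p - q′ * r ≡ s′ * p + (- q′) * r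
  l₁ = solve-∀
  l₂ : ∀ s′ q′ g → 0ℤ ≡ s′ * (q′ * g) + (- q′) * (s′ * g)
  l₂ = solve-∀
  l₃ : ∀ p q′ r s′ u v → p * (u * q′ + v * s′) ≡ v * (s′ * p - q′ * r) + q′ * (u * p + v * r)
  l₃ = solve-∀
  l₄ : ∀ v q′ g → q′ * g ≡ v * 0ℤ + q′ * g
  l₄ = solve-∀
  l₅ : ∀ p q′ r s′ u v → r * (u * q′ + v * s′) ≡ (- u) * (s′ * p - q′ * r) + s′ * (u * p + v * r)
  l₅ = solve-∀

module RingOfIntegers (Δ : ℤ) where

  infixl 7 _⋆_
  _⋆_ : OK → OK → OK
  _⋆_ = mulK Δ

  private
    t : ℤ
    t = tK Δ

  Nm : OK → ℤ
  Nm (a , b) = a * a + a * b * Δ - b * b * t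

  ⋆-comm : ∀ x y → x ⋆ y ≡ y ⋆ x
  ⋆-comm (a , b) (c , d) = cong₂ _,_ (l₁ a b c d t) (l₂ a b c d Δ)
    where
    l₁ : ∀ a b c d t → a * c + b * d * t ≡ c * a + d * b * t
    l₁ = solve-∀
    l₂ : ∀ a b c d D → a * d + b * c + b * d * D ≡ c * b + d * a + d * b * D
    l₂ = solve-∀

  ⋆-assoc : ∀ x y z → (x ⋆ y) ⋆ z ≡ x ⋆ (y ⋆ z)
  ⋆-assoc (a , b) (c , d) (e , f) = cong₂ _,_ (l₁ a b c d e f t Δ) (l₂ a b c d e f t Δ)
    where
    l₁ : ∀ a b c d e f t D → (a * c + b * d * t) * e + (a * d + b * c + b * d * D) * f * t
       ≡ a * (c * e + d * f * t) + b * (c * f + d * e + d * f * D) * t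
    l₁ = solve-∀
    l₂ : ∀ a b c d e f t D → (a * c + b * d * t) * f + (a * d + b * c + b * d * D) * e
           + (a * d + b * c + b * d * D) * f * D
       ≡ a * (c * f + d * e + d * f * D) + b * (c * e + d * f * t) + b * (c * f + d * e + d * f * D) * D
    l₂ = solve-∀

  ⋆-distribˡ : ∀ x y z → x ⋆ (y ⊕ z) ≡ (x ⋆ y) ⊕ (x ⋆ z)
  ⋆-distribˡ (a , b) (c , d) (e , f) = cong₂ _,_ (l₁ a b c d e f t) (l₂ a b c d e f Δ)
    where
    l₁ : ∀ a b c d e f t → a * (c + e) + b * (d + f) * t ≡ (a * c + b * d * t) + (a * e + b * f * t)
    l₁ = solve-∀
    l₂ : ∀ a b c d e f D → a * (d + f) + b * (c + e) + b * (d + f) * D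
       ≡ (a * d + b * c + b * d * D) + (a * f + b * e + b * f * D)
    l₂ = solve-∀

  ⋆-distribʳ : ∀ x y z → (y ⊕ z) ⋆ x ≡ (y ⋆ x) ⊕ (z ⋆ x)
  ⋆-distribʳ x y z = trans (⋆-comm (y ⊕ z) x) (trans (⋆-distribˡ x y z) (cong₂ _⊕_ (⋆-comm x y) (⋆-comm x z)))

  ⋆-lincomb : ∀ x m y n z → x ⋆ ((m · y) ⊕ (n · z)) ≡ (m · (x ⋆ y)) ⊕ (n · (x ⋆ z))
  ⋆-lincomb (a , b) m (c , d) n (e , f) = cong₂ _,_ (l₁ a b m c d n e f t) (l₂ a b m c d n e f Δ)
    where
    l₁ : ∀ a b m c d n e f t → a * (m * c + n * e) + b * (m * d + n * f) * t
       ≡ m * (a * c + b * d * t) + n * (a * e + b * f * t)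
    l₁ = solve-∀
    l₂ : ∀ a b m c d n e f D → a * (m * d + n * f) + b * (m * c + n * e) + b * (m * d + n * f) * D
       ≡ m * (a * d + b * c + b * d * D) + n * (a * f + b * e + b * f * D)
    l₂ = solve-∀

  ⋆-identityʳ : ∀ x → x ⋆ oneK ≡ x
  ⋆-identityʳ (a , b) = cong₂ _,_ (l₁ a b t) (l₂ a b Δ)
    where
    l₁ : ∀ a b t → a * 1ℤ + b * 0ℤ * t ≡ a
    l₁ = solve-∀
    l₂ : ∀ a b D → a * 0ℤ + b * 1ℤ + b * 0ℤ * D ≡ b
    l₂ = solve-∀

  ⋆-identityˡ : ∀ x → oneK ⋆ x ≡ x
  ⋆-identityˡ x = trans (⋆-comm oneK x) (⋆-identityʳ x)

  ⋆-zeroʳ : ∀ x → x ⋆ zeroK ≡ zeroK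
  ⋆-zeroʳ (a , b) = cong₂ _,_ (l₁ a b t) (l₂ a b Δ)
    where
    l₁ : ∀ a b t → a * 0ℤ + b * 0ℤ * t ≡ 0ℤ
    l₁ = solve-∀
    l₂ : ∀ a b D → a * 0ℤ + b * 0ℤ + b * 0ℤ * D ≡ 0ℤ
    l₂ = solve-∀

  ⋆-conj : ∀ x → x ⋆ conjK Δ x ≡ (Nm x , 0ℤ)
  ⋆-conj (a , b) = cong₂ _,_ (l₁ a b t Δ) (l₂ a b Δ)
    where
    l₁ : ∀ a b t D → a * (a + b * D) + b * (- b) * t ≡ a * a + a * b * D - b * b * t
    l₁ = solve-∀
    l₂ : ∀ a b D → a * (- b) + b * (a + b * D) + b * (- b) * D ≡ 0ℤ
    l₂ = solve-∀

  ℤ⋆ : ∀ n x → (n , 0ℤ) ⋆ x ≡ n · x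
  ℤ⋆ n (a , b) = cong₂ _,_ (l₁ n a b t) (l₂ n a b Δ)
    where
    l₁ : ∀ n a b t → n * a + 0ℤ * b * t ≡ n * a
    l₁ = solve-∀
    l₂ : ∀ n a b D → n * b + 0ℤ * a + 0ℤ * b * D ≡ n * b
    l₂ = solve-∀

  ·-⋆ : ∀ m x y → (m · x) ⋆ y ≡ m · (x ⋆ y)
  ·-⋆ m (a , b) (c , d) = cong₂ _,_ (l₁ m a b c d t) (l₂ m a b c d Δ)
    where
    l₁ : ∀ m a b c d t → m * a * c + m * b * d * t ≡ m * (a * c + b * d * t)
    l₁ = solve-∀
    l₂ : ∀ m a b c d D → m * a * d + m * b * c + m * b * d * D ≡ m * (a * d + b * c + b * d * D)
    l₂ = solve-∀

  ·-⋆-comm : ∀ m x y → (m · x) ⋆ y ≡ (m · y) ⋆ x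
  ·-⋆-comm m x y = trans (·-⋆ m x y) (trans (cong (m ·_) (⋆-comm x y)) (sym (·-⋆ m y x)))

  ⋆-swapˡ : ∀ x y z → x ⋆ (y ⋆ z) ≡ y ⋆ (x ⋆ z)
  ⋆-swapˡ x y z = trans (sym (⋆-assoc x y z)) (trans (cong (_⋆ z) (⋆-comm x y)) (⋆-assoc y x z))

  ⋆-interchange : ∀ a b c d → (a ⋆ b) ⋆ (c ⋆ d) ≡ (a ⋆ d) ⋆ (c ⋆ b)
  ⋆-interchange a b c d = begin
    (a ⋆ b) ⋆ (c ⋆ d)   ≡⟨ ⋆-assoc a b (c ⋆ d) ⟩
    a ⋆ (b ⋆ (c ⋆ d))   ≡⟨ cong (a ⋆_) (⋆-swapˡ b c d) ⟩
    a ⋆ (c ⋆ (b ⋆ d))   ≡⟨ cong (λ z → a ⋆ (c ⋆ z)) (⋆-comm b d) ⟩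
    a ⋆ (c ⋆ (d ⋆ b))   ≡⟨ cong (a ⋆_) (⋆-swapˡ c d b) ⟩
    a ⋆ (d ⋆ (c ⋆ b))   ≡⟨ ⋆-assoc a d (c ⋆ b) ⟨
    (a ⋆ d) ⋆ (c ⋆ b)   ∎
    where open ≡-Reasoning

  conj-det : ∀ β δ → (conjK Δ β ⋆ δ) ⊝ (β ⋆ conjK Δ δ) ≡ det β δ · sqrtΔ Δ
  conj-det (p , q) (r , s) = cong₂ _,_ (l₁ p q r s t Δ) (l₂ p q r s Δ)
    where
    l₁ : ∀ p q r s t D → ((p + q * D) * r + (- q) * s * t) + - (p * (r + s * D) + q * (- s) * t)
       ≡ (p * s - q * r) * (+ 0 + - (+ 0 + + 1 * D))
    l₁ = solve-∀
    l₂ : ∀ p q r s D → ((p + q * D) * s + (- q) * r + (- q) * s * D) + - (p * (- s) + q * (r + s * D) + q * (- s) * D)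
       ≡ (p * s - q * r) * (+ 1 + - (- (+ 1)))
    l₂ = solve-∀

  coprime-rebase : ∀ {β δ β′ δ′} → Coprime Δ β δ → Span β′ δ′ β → Span β′ δ′ δ → Coprime Δ β′ δ′
  coprime-rebase {β′ = β′} {δ′} (X , Z , eq) (m₁ , n₁ , refl) (m₂ , n₂ , refl) =
    (m₁ · X) ⊕ (m₂ · Z) , (n₁ · X) ⊕ (n₂ · Z) , trans (sym (rebase X Z β′ δ′)) eq
    where
    rebase : ∀ X Z β δ → (X ⋆ ((m₁ · β) ⊕ (n₁ · δ))) ⊕ (Z ⋆ ((m₂ · β) ⊕ (n₂ · δ)))
           ≡ (((m₁ · X) ⊕ (m₂ · Z)) ⋆ β) ⊕ (((n₁ · X) ⊕ (n₂ · Z)) ⋆ δ)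
    rebase (x₁ , x₂) (z₁ , z₂) (p , q) (r , s) =
      cong₂ _,_ (l₁ x₁ x₂ z₁ z₂ m₁ n₁ m₂ n₂ p q r s t) (l₂ x₁ x₂ z₁ z₂ m₁ n₁ m₂ n₂ p q r s Δ)
      where
      l₁ : ∀ a b c d m₁ n₁ m₂ n₂ p q r s t →
        (a * (m₁ * p + n₁ * r) + b * (m₁ * q + n₁ * s) * t) + (c * (m₂ * p + n₂ * r) + d * (m₂ * q + n₂ * s) * t)
        ≡ ((m₁ * a + m₂ * c) * p + (m₁ * b + m₂ * d) * q * t) + ((n₁ * a + n₂ * c) * r + (n₁ * b + n₂ * d) * s * t)
      l₁ = solve-∀
      l₂ : ∀ a b c d m₁ n₁ m₂ n₂ p q r s D →
        (a * (m₁ * q + n₁ * s) + b * (m₁ * p + n₁ * r) + b * (m₁ * q + n₁ * s) * D)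
          + (c * (m₂ * q + n₂ * s) + d * (m₂ * p + n₂ * r) + d * (m₂ * q + n₂ * s) * D)
        ≡ ((m₁ * a + m₂ * c) * q + (m₁ * b + m₂ * d) * p + (m₁ * b + m₂ * d) * q * D)
          + ((n₁ * a + n₂ * c) * s + (n₁ * b + n₂ * d) * r + (n₁ * b + n₂ * d) * s * D)
      l₂ = solve-∀

  norm-expansion : ∀ X Z a b c → ∃[ q ] ∃[ r ]
    Nm ((X ⋆ (a , 0ℤ)) ⊕ (Z ⋆ (b , c))) ≡ a * a * Nm X + a * (b * q + c * r) + Nm Z * Nm (b , c)
  norm-expansion (x₁ , x₂) (z₁ , z₂) a b c =
    + 2 * x₁ * z₁ + (x₁ * z₂ + x₂ * z₁) * Δ - + 2 * x₂ * z₂ * t ,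
    + 2 * x₁ * z₂ * t + (x₁ * (z₁ + z₂ * Δ) + x₂ * z₂ * t) * Δ - + 2 * x₂ * (z₁ + z₂ * Δ) * t ,
    l x₁ x₂ z₁ z₂ a b c t Δ
    where
    l : ∀ x₁ x₂ z₁ z₂ a b c t D →
      let P = (x₁ * a + x₂ * 0ℤ * t) + (z₁ * b + z₂ * c * t)
          Q = (x₁ * 0ℤ + x₂ * a + x₂ * 0ℤ * D) + (z₁ * c + z₂ * b + z₂ * c * D)
      in P * P + P * Q * D - Q * Q * t
         ≡ a * a * (x₁ * x₁ + x₁ * x₂ * D - x₂ * x₂ * t)
           + a * (b * (+ 2 * x₁ * z₁ + (x₁ * z₂ + x₂ * z₁) * D - + 2 * x₂ * z₂ * t)
                  + c * (+ 2 * x₁ * z₂ * t + (x₁ * (z₁ + z₂ * D) + x₂ * z₂ * t) * D - + 2 * x₂ * (z₁ + z₂ * D) * t))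
           + (z₁ * z₁ + z₁ * z₂ * D - z₂ * z₂ * t) * (b * b + b * c * D - c * c * t)
    l = solve-∀

  module _ (disc : ImagQuadDisc Δ) where

    -- tK Δ is defined by flooring division, which is exact because 4 ∣ Δ - Δ².
    4t≡Δ-Δ² : + 4 * tK Δ ≡ Δ - Δ * Δ
    4t≡Δ-Δ² = n*[i/n]≡i (Δ - Δ * Δ) 4 (4∣Δ-Δ² (proj₂ disc))
      where
      4∣Δ-Δ² : _ → + 4 ∣ Δ - Δ * Δ
      4∣Δ-Δ² (inj₁ (4∣Δ-1 , _)) =
        subst (+ 4 ∣_) (l Δ) (∣n⇒∣m*n (- Δ) (∣ᵤ⇒∣ 4∣Δ-1))
        where
        l : ∀ D → - D * (D - + 1) ≡ D - D * D
        l = solve-∀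
      4∣Δ-Δ² (inj₂ (m , Δ≡4m , _)) =
        divides (m - + 4 * m * m) (trans (cong (λ D → D - D * D) Δ≡4m) (l m))
        where
        l : ∀ m → + 4 * m - + 4 * m * (+ 4 * m) ≡ (m - + 4 * m * m) * + 4
        l = solve-∀

    4Nm≡sum-of-squares : ∀ a b → + 4 * Nm (a , b) ≡ (+ 2 * a + b * Δ) * (+ 2 * a + b * Δ) + b * b * (- Δ)
    4Nm≡sum-of-squares a b = begin
      + 4 * Nm (a , b)                          ≡⟨ l₁ a b Δ t ⟩
      s * s + b * b * (- Δ) + b * b * ((Δ - Δ * Δ) - + 4 * t)
                                                ≡⟨ cong (λ z → s * s + b * b * (- Δ) + b * b * (z - + 4 * t)) 4t≡Δ-Δ² ⟨
      s * s + b * b * (- Δ) + b * b * (+ 4 * t - + 4 * t)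
                                                ≡⟨ cong (λ z → s * s + b * b * (- Δ) + b * b * z) (ℤP.+-inverseʳ (+ 4 * t)) ⟩
      s * s + b * b * (- Δ) + b * b * 0ℤ       ≡⟨ l₂ s b Δ ⟩
      s * s + b * b * (- Δ)                     ∎
      where
      open ≡-Reasoning
      s : ℤ
      s = + 2 * a + b * Δ
      l₁ : ∀ a b D t → + 4 * (a * a + a * b * D - b * b * t)
         ≡ (+ 2 * a + b * D) * (+ 2 * a + b * D) + b * b * (- D) + b * b * ((D - D * D) - + 4 * t)
      l₁ = solve-∀
      l₂ : ∀ s b D → s * s + b * b * (- D) + b * b * 0ℤ ≡ s * s + b * b * (- D)
      l₂ = solve-∀

    Nm≡0⇒≡0 : ∀ x → Nm x ≡ 0ℤ → x ≡ zeroK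
    Nm≡0⇒≡0 (a , b) Nm≡0 = cong₂ _,_ a≡0 b≡0
      where
      k : ℕ
      k = proj₁ (i<0⇒-i≡+[1+k] (proj₁ disc))
      s : ℤ
      s = + 2 * a + b * Δ
      s≡0×b≡0 : s ≡ 0ℤ × b ≡ 0ℤ
      s≡0×b≡0 = i*i+j*j*[1+k]≡0⇒i≡0×j≡0 s b k (begin
        s * s + b * b * + suc k ≡⟨ cong (λ z → s * s + b * b * z) (proj₂ (i<0⇒-i≡+[1+k] (proj₁ disc))) ⟨
        s * s + b * b * (- Δ)   ≡⟨ 4Nm≡sum-of-squares a b ⟨
        + 4 * Nm (a , b)        ≡⟨ cong (+ 4 *_) Nm≡0 ⟩
        0ℤ                      ∎)
        where open ≡-Reasoning
      b≡0 : b ≡ 0ℤ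
      b≡0 = proj₂ s≡0×b≡0
      2a≡0 : + 2 * a ≡ 0ℤ
      2a≡0 = trans (sym (ℤP.+-identityʳ (+ 2 * a)))
        (trans (cong (λ z → + 2 * a + z * Δ) (sym b≡0)) (proj₁ s≡0×b≡0))
      a≡0 : a ≡ 0ℤ
      a≡0 = i*j≡0⇒i≡0 a (+ 2) (trans (ℤP.*-comm a (+ 2)) 2a≡0)

    ⋆-cancelˡ : ∀ γ {x y} → ¬ γ ≡ zeroK → γ ⋆ x ≡ γ ⋆ y → x ≡ y
    ⋆-cancelˡ γ {x₁ , x₂} {y₁ , y₂} γ≢0 eq =
      cong₂ _,_ (ℤP.*-cancelˡ-≡ (Nm γ) _ _ (cong proj₁ scaled)) (ℤP.*-cancelˡ-≡ (Nm γ) _ _ (cong proj₂ scaled))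
      where
      instance
        Nmγ≢0 : ℤ.NonZero (Nm γ)
        Nmγ≢0 = ℤ.≢-nonZero (λ Nm≡0 → γ≢0 (Nm≡0⇒≡0 γ Nm≡0))
      conj⋆⋆ : ∀ z → conjK Δ γ ⋆ (γ ⋆ z) ≡ Nm γ · z
      conj⋆⋆ z = begin
        conjK Δ γ ⋆ (γ ⋆ z)   ≡⟨ ⋆-assoc (conjK Δ γ) γ z ⟨
        (conjK Δ γ ⋆ γ) ⋆ z   ≡⟨ cong (_⋆ z) (trans (⋆-comm (conjK Δ γ) γ) (⋆-conj γ)) ⟩
        (Nm γ , 0ℤ) ⋆ z       ≡⟨ ℤ⋆ (Nm γ) z ⟩
        Nm γ · z              ∎
        where open ≡-Reasoning
      scaled : Nm γ · (x₁ , x₂) ≡ Nm γ · (y₁ , y₂)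
      scaled = trans (sym (conj⋆⋆ _)) (trans (cong (conjK Δ γ ⋆_) eq) (conj⋆⋆ _))

module Lattices (Δ : ℤ) where
  open RingOfIntegers Δ

  private
    t : ℤ
    t = tK Δ

  module Basis {Λ : OK → Set} {β δ : OK} (basis : IsBasis Δ Λ β δ) where

    toSpan : ∀ {x} → Λ x → Span β δ x
    toSpan {x} = Equivalence.to (proj₂ basis x)

    fromSpan : ∀ {x} → Span β δ x → Λ x
    fromSpan {x} = Equivalence.from (proj₂ basis x)

    β∈ : Λ β
    β∈ = fromSpan (span-left β δ)

    δ∈ : Λ δ
    δ∈ = fromSpan (span-right β δ)

    ∈-⊝ : ∀ {x y} → Λ x → Λ y → Λ (x ⊝ y)
    ∈-⊝ x∈ y∈ = fromSpan (span-⊝ (toSpan x∈) (toSpan y∈))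

    Ord-from-basis : ∀ α → Λ (α ⋆ β) → Λ (α ⋆ δ) → Ord Δ Λ α
    Ord-from-basis α αβ∈ αδ∈ x x∈ with toSpan x∈
    ... | m , n , refl =
      fromSpan (subst (Span β δ) (sym (⋆-lincomb α m β n δ)) (span-lincomb (toSpan αβ∈) (toSpan αδ∈) m n))

  change-of-basis : ∀ {Λ β δ β′ δ′} → IsBasis Δ Λ β δ → LinearlyIndependent β′ δ′ →
                    Span β′ δ′ β → Span β′ δ′ δ → Span β δ β′ → Span β δ δ′ → IsBasis Δ Λ β′ δ′
  change-of-basis basis indep pβ pδ pβ′ pδ′ = indep , λ x →
    mk⇔ (λ x∈ → span-⊆ pβ pδ (Basis.toSpan basis x∈)) (λ x∈ → Basis.fromSpan basis (span-⊆ pβ′ pδ′ x∈))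

  index-≤ : ∀ {Λ n m} → (∀ {x y} → Λ x → Λ y → Λ (x ⊝ y)) → Index Δ Λ n → Index Δ Λ m → n ≤ m
  index-≤ {Λ} {n} {m} ∈-⊝ (r , r-irredundant , _) (r′ , _ , r′-complete) = FinP.injective⇒≤ F-injective
    where
    F : Fin n → Fin m
    F i = proj₁ (r′-complete (r i))
    F-injective : ∀ {i j} → F i ≡ F j → i ≡ j
    F-injective {i} {j} Fi≡Fj = r-irredundant i j (subst Λ (⊝-⊝-cancelʳ (r i) (r′ (F i)) (r j))
      (∈-⊝ (proj₂ (r′-complete (r i)))
           (subst (λ k → Λ (r j ⊝ r′ k)) (sym Fi≡Fj) (proj₂ (r′-complete (r j))))))

  index-unique : ∀ {Λ n m} → (∀ {x y} → Λ x → Λ y → Λ (x ⊝ y)) → Index Δ Λ n → Index Δ Λ m → n ≡ m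
  index-unique {Λ} ∈-⊝ i j = ℕP.≤-antisym (index-≤ {Λ} ∈-⊝ i j) (index-≤ {Λ} ∈-⊝ j i)

  record HermiteForm (Λ : OK → Set) (β δ : OK) : Set where
    field
      a c : ℕ
      {{a≢0}} : ℕ.NonZero a
      {{c≢0}} : ℕ.NonZero c
      b : ℤ
      basis : IsBasis Δ Λ (+ a , 0ℤ) (b , + c)
      ∣det∣≡ac : ∣ det β δ ∣ ≡ a ℕ.* c

  hermiteForm : ∀ {Λ β δ} → IsBasis Δ Λ β δ → HermiteForm Λ β δ
  hermiteForm {Λ} {p , q} {r , s} basis with bezout q s
  ... | g , divides q′ q≡q′g , divides s′ s≡s′g , u , v , g≡uq+vs = record
    { a = ∣ D′ ∣ ; c = g ; b = u * p + v * r
    ; basis = change-of-basis basis (triangular-independent ∣ D′ ∣ g _)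
                (span-⊆ e₁′∈ (span-right e₁ e₂) (proj₁ (proj₂ (proj₂ spans))))
                (span-⊆ e₁′∈ (span-right e₁ e₂) (proj₂ (proj₂ (proj₂ spans))))
                (subst (Span _ _) (sym e₁≡σe₁′) (span-· σ (proj₁ spans)))
                (proj₁ (proj₂ spans))
    ; ∣det∣≡ac = trans (cong ∣_∣ det≡D′g) (ℤP.abs-* D′ (+ g))
    }
    where
    D′ : ℤ
    D′ = s′ * p - q′ * r
    det≡D′g : det (p , q) (r , s) ≡ D′ * + g
    det≡D′g = trans (cong₂ (λ s q → p * s - q * r) s≡s′g q≡q′g) (l p s′ q′ r (+ g))
      where
      l : ∀ p s′ q′ r g → p * (s′ * g) - q′ * g * r ≡ (s′ * p - q′ * r) * g
      l = solve-∀
    det≢0 : det (p , q) (r , s) ≢ 0ℤ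
    det≢0 = independent⇒det≢0 (proj₁ basis)
    instance
      g≢0 : ℕ.NonZero g
      g≢0 = ℕ.≢-nonZero λ g≡0 → det≢0 (trans det≡D′g (trans (cong (λ g → D′ * + g) g≡0) (ℤP.*-zeroʳ D′)))
      ∣D′∣≢0 : ℕ.NonZero ∣ D′ ∣
      ∣D′∣≢0 = ℕ.≢-nonZero λ ∣D′∣≡0 → det≢0 (trans det≡D′g
        (trans (cong (_* + g) (ℤP.∣i∣≡0⇒i≡0 {D′} ∣D′∣≡0)) (ℤP.*-zeroˡ (+ g))))
    e₁ e₁′ e₂ : OK
    e₁  = (+ ∣ D′ ∣ , 0ℤ)
    e₁′ = (D′ , 0ℤ)
    e₂  = (u * p + v * r , + g)
    spans : Span (p , q) (r , s) e₁′ × Span (p , q) (r , s) e₂ × Span e₁′ e₂ (p , q) × Span e₁′ e₂ (r , s)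
    spans = gcd-triangular-basis p r {q′ = q′} {s′} {u} {v} q≡q′g s≡s′g g≡uq+vs
               (cofactors-coprime {q′ = q′} {s′} {u} {v} q≡q′g s≡s′g g≡uq+vs)
    σ : ℤ
    σ = proj₁ (sign-factor D′)
    e₁≡σe₁′ : e₁ ≡ σ · e₁′
    e₁≡σe₁′ = cong₂ _,_ (proj₁ (proj₂ (sign-factor D′))) (sym (ℤP.*-zeroʳ σ))
    e₁′∈ : Span e₁ e₂ e₁′
    e₁′∈ = subst (λ e → Span e e₂ e₁′) (sym e₁≡σe₁′)
             (span-·-unit {σ} e₁′ e₂ (proj₂ (proj₂ (sign-factor D′))))

  module Triangular {Λ : OK → Set} (a c : ℕ) .{{_ : ℕ.NonZero a}} .{{_ : ℕ.NonZero c}} (b : ℤ)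
                    (basis : IsBasis Δ Λ (+ a , 0ℤ) (b , + c)) where
    open Basis basis

    representative : Fin a × Fin c → OK
    representative (i , j) = (+ toℕ i , + toℕ j)

    representative-irredundant : ∀ i j → Λ (representative i ⊝ representative j) → i ≡ j
    representative-irredundant (i , j) (i′ , j′) diff∈ with toSpan diff∈
    ... | m , n , eq = cong₂ _,_ i≡i′ j≡j′
      where
      l₁ : ∀ m n c → m * 0ℤ + n * c ≡ n * c
      l₁ = solve-∀
      second : + toℕ j - + toℕ j′ ≡ n * + c
      second = trans (cong proj₂ eq) (l₁ m n (+ c))
      toℕj≡toℕj′ : toℕ j ≡ toℕ j′
      toℕj≡toℕj′ = residue-unique (FinP.toℕ<n j) (FinP.toℕ<n j′) n (x-y≡z⇒x≡y+z _ (+ toℕ j′) second)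
      j≡j′ : j ≡ j′
      j≡j′ = FinP.toℕ-injective toℕj≡toℕj′
      n≡0 : n ≡ 0ℤ
      n≡0 = i*j≡0⇒i≡0 n (+ c) (trans (sym second)
        (trans (cong (λ z → + z - + toℕ j′) toℕj≡toℕj′) (ℤP.+-inverseʳ (+ toℕ j′))))
      l₂ : ∀ m a b → m * a + 0ℤ * b ≡ m * a
      l₂ = solve-∀
      first : + toℕ i - + toℕ i′ ≡ m * + a
      first = trans (cong proj₁ eq) (trans (cong (λ z → m * + a + z * b) n≡0) (l₂ m (+ a) b))
      i≡i′ : i ≡ i′
      i≡i′ = FinP.toℕ-injective
        (residue-unique (FinP.toℕ<n i) (FinP.toℕ<n i′) m (x-y≡z⇒x≡y+z _ (+ toℕ i′) first))

    representative-complete : ∀ x → ∃[ k ] Λ (x ⊝ representative k)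
    representative-complete (x₁ , x₂) = (i , j) , fromSpan (q₁ , q₂ , cong₂ _,_ first second)
      where
      q₂ y q₁ : ℤ
      q₂ = x₂ ℤ./ + c
      y  = x₁ - q₂ * b
      q₁ = y ℤ./ + a
      i : Fin a
      i = fromℕ< (ℤDM.n%d<d y (+ a))
      j : Fin c
      j = fromℕ< (ℤDM.n%d<d x₂ (+ c))
      l₁ : ∀ x₁ q₂ b r q₁ a → x₁ - q₂ * b ≡ r + q₁ * a → x₁ + - r ≡ q₁ * a + q₂ * b
      l₁ x₁ q₂ b r q₁ a e = trans (m₁ x₁ q₂ b r) (trans (cong (λ z → z + - r + q₂ * b) e) (m₂ r q₁ a q₂ b))
        where
        m₁ : ∀ x₁ q₂ b r → x₁ + - r ≡ (x₁ - q₂ * b) + - r + q₂ * b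
        m₁ = solve-∀
        m₂ : ∀ r q₁ a q₂ b → r + q₁ * a + - r + q₂ * b ≡ q₁ * a + q₂ * b
        m₂ = solve-∀
      l₂ : ∀ x₂ r q₂ c q₁ → x₂ ≡ r + q₂ * c → x₂ + - r ≡ q₁ * 0ℤ + q₂ * c
      l₂ x₂ r q₂ c q₁ refl = m r q₂ c q₁
        where
        m : ∀ r q₂ c q₁ → r + q₂ * c + - r ≡ q₁ * 0ℤ + q₂ * c
        m = solve-∀
      first : x₁ + - + toℕ i ≡ q₁ * + a + q₂ * b
      first rewrite FinP.toℕ-fromℕ< (ℤDM.n%d<d y (+ a)) = l₁ x₁ q₂ b _ q₁ (+ a) (ℤDM.a≡a%n+[a/n]*n y (+ a))
      second : x₂ + - + toℕ j ≡ q₁ * 0ℤ + q₂ * + c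
      second rewrite FinP.toℕ-fromℕ< (ℤDM.n%d<d x₂ (+ c)) = l₂ x₂ _ q₂ (+ c) q₁ (ℤDM.a≡a%n+[a/n]*n x₂ (+ c))

    index : Index Δ Λ (a ℕ.* c)
    index = (λ k → representative (remQuot c k)) , irredundant , complete
      where
      irredundant : ∀ k l → Λ (representative (remQuot c k) ⊝ representative (remQuot c l)) → k ≡ l
      irredundant k l diff∈ = begin
        k                             ≡⟨ FinP.combine-remQuot {a} c k ⟨
        uncurry combine (remQuot {a} c k)
          ≡⟨ cong (uncurry combine) (representative-irredundant (remQuot c k) (remQuot c l) diff∈) ⟩
        uncurry combine (remQuot {a} c l) ≡⟨ FinP.combine-remQuot {a} c l ⟩
        l                             ∎
        where open ≡-Reasoning
      complete : ∀ x → ∃[ k ] Λ (x ⊝ representative (remQuot c k))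
      complete x with representative-complete x
      ... | (i , j) , x-r∈ =
        combine i j , subst (λ ij → Λ (x ⊝ representative ij)) (sym (FinP.remQuot-combine i j)) x-r∈

    e₁ e₂ : OK
    e₁ = (+ a , 0ℤ)
    e₂ = (b , + c)

    -- The condition on y for x + yω ∈ Ord Λ.
    Stabilising : ℤ → Set
    Stabilising y = (+ c ∣ y * + a) × (+ c ∣ y * b) × (+ a * + c ∣ y * Nm e₂)

    Ord⇒stabilising : ∀ x y → Ord Δ Λ (x , y) → Stabilising y
    Ord⇒stabilising x y ord with toSpan (ord e₁ β∈) | toSpan (ord e₂ δ∈)
    ... | m , n , eq₁ | m′ , n′ , eq₂ =
      divides n (first (cong proj₂ eq₁)) ,
      divides (n′ - x - y * Δ) (second (cong proj₂ eq₂)) ,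
      divides (- m′) (third (cong proj₁ eq₂) (cong proj₂ eq₂))
      where
      first : x * 0ℤ + y * + a + y * 0ℤ * Δ ≡ m * 0ℤ + n * + c → y * + a ≡ n * + c
      first e = trans (l₁ x y (+ a) Δ) (trans e (l₂ m n (+ c)))
        where
        l₁ : ∀ x y a D → y * a ≡ x * 0ℤ + y * a + y * 0ℤ * D
        l₁ = solve-∀
        l₂ : ∀ m n c → m * 0ℤ + n * c ≡ n * c
        l₂ = solve-∀
      second : x * + c + y * b + y * + c * Δ ≡ m′ * 0ℤ + n′ * + c → y * b ≡ (n′ - x - y * Δ) * + c
      second e = trans (l₁ x y b (+ c) Δ) (trans (cong (λ z → z - x * + c - y * + c * Δ) e) (l₂ x y (+ c) Δ m′ n′))
        where
        l₁ : ∀ x y b c D → y * b ≡ (x * c + y * b + y * c * D) - x * c - y * c * D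
        l₁ = solve-∀
        l₂ : ∀ x y c D m′ n′ → (m′ * 0ℤ + n′ * c) - x * c - y * c * D ≡ (n′ - x - y * D) * c
        l₂ = solve-∀
      third : x * b + y * + c * t ≡ m′ * + a + n′ * b → x * + c + y * b + y * + c * Δ ≡ m′ * 0ℤ + n′ * + c →
              y * Nm e₂ ≡ (- m′) * (+ a * + c)
      third e e′ = trans (l₁ x y b (+ c) Δ t) (trans (cong₂ (λ u v → b * v - + c * u) e e′) (l₂ b (+ c) (+ a) m′ n′))
        where
        l₁ : ∀ x y b c D t → y * (b * b + b * c * D - c * c * t) ≡ b * (x * c + y * b + y * c * D) - c * (x * b + y * c * t)
        l₁ = solve-∀
        l₂ : ∀ b c a m′ n′ → b * (m′ * 0ℤ + n′ * c) - c * (m′ * a + n′ * b) ≡ (- m′) * (a * c)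
        l₂ = solve-∀

    k₁b≡k₂a : ∀ y k₁ k₂ → y * + a ≡ k₁ * + c → y * b ≡ k₂ * + c → k₁ * b ≡ k₂ * + a
    k₁b≡k₂a y k₁ k₂ ya≡k₁c yb≡k₂c = ℤP.*-cancelʳ-≡ _ _ (+ c) (begin
      k₁ * b * + c    ≡⟨ l k₁ b (+ c) ⟩
      k₁ * + c * b    ≡⟨ cong (_* b) ya≡k₁c ⟨
      y * + a * b     ≡⟨ l y (+ a) b ⟩
      y * b * + a     ≡⟨ cong (_* + a) yb≡k₂c ⟩
      k₂ * + c * + a  ≡⟨ l k₂ (+ c) (+ a) ⟩
      k₂ * + a * + c  ∎)
      where
      open ≡-Reasoning
      l : ∀ x y z → x * y * z ≡ x * z * y
      l = solve-∀

    ⋆e₁∈span : ∀ x y k₁ k₂ → y * + a ≡ k₁ * + c → y * b ≡ k₂ * + c → Span e₁ e₂ ((x , y) ⋆ e₁)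
    ⋆e₁∈span x y k₁ k₂ ya≡k₁c yb≡k₂c =
      x - k₂ , k₁ , cong₂ _,_ (trans (l₁ x y (+ a) t k₂)
                                     (cong (λ z → (x - k₂) * + a + z) (sym (k₁b≡k₂a y k₁ k₂ ya≡k₁c yb≡k₂c))))
                              (trans (l₂ x y (+ a) Δ) (trans ya≡k₁c (l₃ x k₂ k₁ (+ c))))
      where
      l₁ : ∀ x y a t k → x * a + y * 0ℤ * t ≡ (x - k) * a + k * a
      l₁ = solve-∀
      l₂ : ∀ x y a D → x * 0ℤ + y * a + y * 0ℤ * D ≡ y * a
      l₂ = solve-∀
      l₃ : ∀ x k₂ k₁ c → k₁ * c ≡ (x - k₂) * 0ℤ + k₁ * c
      l₃ = solve-∀

    ⋆e₂∈span : ∀ x y k₂ k₃ → y * b ≡ k₂ * + c → y * Nm e₂ ≡ k₃ * (+ a * + c) → Span e₁ e₂ ((x , y) ⋆ e₂)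
    ⋆e₂∈span x y k₂ k₃ yb≡k₂c yN≡k₃ac = - k₃ , x + k₂ + y * Δ ,
      cong₂ _,_ (trans (l₁ x y (+ c) t k₂ b Δ) (cong (λ z → z + (x + k₂ + y * Δ) * b) w≡-k₃a))
                (trans (cong (λ z → x * + c + z + y * + c * Δ) yb≡k₂c) (l₂ x k₂ (+ c) y Δ k₃))
      where
      l₁ : ∀ x y c t k₂ b D → x * b + y * c * t ≡ (y * c * t - k₂ * b - y * D * b) + (x + k₂ + y * D) * b
      l₁ = solve-∀
      l₂ : ∀ x k₂ c y D k₃ → x * c + k₂ * c + y * c * D ≡ (- k₃) * 0ℤ + (x + k₂ + y * D) * c
      l₂ = solve-∀
      l₃ : ∀ y c t k₂ b D → (y * c * t - k₂ * b - y * D * b) * c ≡ y * c * c * t - (k₂ * c) * b - y * D * b * c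
      l₃ = solve-∀
      l₄ : ∀ y c t b D → y * c * c * t - (y * b) * b - y * D * b * c ≡ - (y * (b * b + b * c * D - c * c * t))
      l₄ = solve-∀
      l₅ : ∀ k a c → - (k * (a * c)) ≡ (- k) * a * c
      l₅ = solve-∀
      w≡-k₃a : y * + c * t - k₂ * b - y * Δ * b ≡ (- k₃) * + a
      w≡-k₃a = ℤP.*-cancelʳ-≡ _ _ (+ c) (begin
        (y * + c * t - k₂ * b - y * Δ * b) * + c           ≡⟨ l₃ y (+ c) t k₂ b Δ ⟩
        y * + c * + c * t - (k₂ * + c) * b - y * Δ * b * + c
          ≡⟨ cong (λ z → y * + c * + c * t - z * b - y * Δ * b * + c) yb≡k₂c ⟨
        y * + c * + c * t - (y * b) * b - y * Δ * b * + c  ≡⟨ l₄ y (+ c) t b Δ ⟩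
        - (y * Nm e₂)                                      ≡⟨ cong -_ yN≡k₃ac ⟩
        - (k₃ * (+ a * + c))                               ≡⟨ l₅ k₃ (+ a) (+ c) ⟩
        (- k₃) * + a * + c                                 ∎)
        where open ≡-Reasoning

    stabilising⇒Ord : ∀ x y → Stabilising y → Ord Δ Λ (x , y)
    stabilising⇒Ord x y (divides k₁ ya≡k₁c , divides k₂ yb≡k₂c , divides k₃ yN≡k₃ac) =
      Ord-from-basis (x , y) (fromSpan (⋆e₁∈span x y k₁ k₂ ya≡k₁c yb≡k₂c))
                             (fromSpan (⋆e₂∈span x y k₂ k₃ yb≡k₂c yN≡k₃ac))

    ac∣⇒stabilising : ∀ y → + a * + c ∣ y → Stabilising y
    ac∣⇒stabilising y ac∣y = ∣m⇒∣m*n (+ a) c∣y , ∣m⇒∣m*n b c∣y , ∣m⇒∣m*n (Nm e₂) ac∣y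
      where
      c∣y : + c ∣ y
      c∣y = ∣-trans (divides (+ a) refl) ac∣y

    -- Take norms in 1 = X e₁ + Z e₂ and multiply by y: every term becomes divisible by ac.
    coprime⇒stabilising⇒ac∣ : Coprime Δ e₁ e₂ → ∀ y → Stabilising y → + a * + c ∣ y
    coprime⇒stabilising⇒ac∣ (X , Z , eq) y (c∣ya , c∣yb , ac∣yN) =
      subst (+ a * + c ∣_) (sym y-expansion)
        (∣m∣n⇒∣m+n (∣m∣n⇒∣m+n (∣m∣n⇒∣m+n
          (∣m⇒∣m*n (Nm X) (*-monoʳ-∣ (+ a) c∣ya))
          (∣m⇒∣m*n q (*-monoʳ-∣ (+ a) c∣yb)))
          (∣m⇒∣m*n (y * r) ∣-refl))
          (∣m⇒∣m*n (Nm Z) ac∣yN))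
      where
      q r : ℤ
      q = proj₁ (norm-expansion X Z (+ a) b (+ c))
      r = proj₁ (proj₂ (norm-expansion X Z (+ a) b (+ c)))
      y-expansion : y ≡ + a * (y * + a) * Nm X + + a * (y * b) * q + + a * + c * (y * r) + y * Nm e₂ * Nm Z
      y-expansion = begin
        y                   ≡⟨ l₁ y Δ t ⟩
        y * Nm oneK         ≡⟨ cong (λ w → y * Nm w) eq ⟨
        y * Nm ((X ⋆ e₁) ⊕ (Z ⋆ e₂))
                            ≡⟨ cong (y *_) (proj₂ (proj₂ (norm-expansion X Z (+ a) b (+ c)))) ⟩
        y * (+ a * + a * Nm X + + a * (b * q + + c * r) + Nm Z * Nm e₂)
                            ≡⟨ l₂ y (+ a) b (+ c) (Nm X) q r (Nm Z) (Nm e₂) ⟩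
        + a * (y * + a) * Nm X + + a * (y * b) * q + + a * + c * (y * r) + y * Nm e₂ * Nm Z ∎
        where
        open ≡-Reasoning
        l₁ : ∀ y D t → y ≡ y * (1ℤ * 1ℤ + 1ℤ * 0ℤ * D - 0ℤ * 0ℤ * t)
        l₁ = solve-∀
        l₂ : ∀ y a b c NX q r NZ N → y * (a * a * NX + a * (b * q + c * r) + NZ * N)
           ≡ a * (y * a) * NX + a * (y * b) * q + a * c * (y * r) + y * N * NZ
        l₂ = solve-∀

    conductor : Coprime Δ e₁ e₂ → Conductor Δ Λ (a ℕ.* c)
    conductor coprime = ℕ.>-nonZero⁻¹ (a ℕ.* c) {{ℕP.m*n≢0 a c}} , λ { (x , y) → mk⇔
      (λ ord → ∣⇒∣ᵤ (subst (_∣ y) (sym (ℤP.pos-* a c))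
        (coprime⇒stabilising⇒ac∣ coprime y (Ord⇒stabilising x y ord))))
      (λ ac∣y → stabilising⇒Ord x y (ac∣⇒stabilising y (subst (_∣ y) (ℤP.pos-* a c) (∣ᵤ⇒∣ ac∣y)))) }

    cond1⇒cond2 : Cond1 Δ Λ → Cond2 Δ Λ
    cond1⇒cond2 (β , δ , basis′ , coprime) =
      a ℕ.* c ,
      conductor (coprime-rebase coprime (toSpan (Basis.β∈ basis′)) (toSpan (Basis.δ∈ basis′))) ,
      index

    cofactor-stabilising : ∀ y d → + a * + c ≡ y * + d →
                           + d ∣ + a * + a → + d ∣ + a * b → + d ∣ Nm e₂ → Stabilising y
    cofactor-stabilising y d ac≡yd d∣aa d∣ab d∣N =
      *-cancelʳ-∣ (+ a) (subst₂ _∣_ (ℤP.*-comm (+ a) (+ c)) (trans (l (+ a) y (+ a)) (ℤP.*-comm (+ a) (y * + a)))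
                                    (ac∣y* d∣aa)) ,
      *-cancelˡ-∣ (+ a) (subst (_ ∣_) (l (+ a) y b) (ac∣y* d∣ab)) ,
      ac∣y* d∣N
      where
      ac∣y* : ∀ {m} → + d ∣ m → + a * + c ∣ y * m
      ac∣y* d∣m = subst (_∣ _) (sym ac≡yd) (*-monoʳ-∣ y d∣m)
      l : ∀ a y m → y * (a * m) ≡ a * (y * m)
      l = solve-∀

    combination⇒coprime : ∀ c₁ c₂ c₃ c₄ → 1ℤ ≡ c₁ * (+ a * + c) + c₂ * (+ a * + a) + c₃ * (+ a * b) + c₄ * Nm e₂ →
                          Coprime Δ e₁ e₂
    combination⇒coprime c₁ c₂ c₃ c₄ 1≡comb =
      (c₁ * + c + c₂ * + a + c₃ * b , 0ℤ) , c₄ · conjK Δ e₂ ,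
      cong₂ _,_ (trans (l₁ c₁ c₂ c₃ c₄ (+ a) (+ c) b t Δ) (sym 1≡comb)) (l₂ c₁ c₂ c₃ c₄ (+ a) (+ c) b Δ)
      where
      l₁ : ∀ c₁ c₂ c₃ c₄ a c b t D →
           ((c₁ * c + c₂ * a + c₃ * b) * a + 0ℤ * 0ℤ * t) + (c₄ * (b + c * D) * b + c₄ * (- c) * c * t)
         ≡ c₁ * (a * c) + c₂ * (a * a) + c₃ * (a * b) + c₄ * (b * b + b * c * D - c * c * t)
      l₁ = solve-∀
      l₂ : ∀ c₁ c₂ c₃ c₄ a c b D →
           ((c₁ * c + c₂ * a + c₃ * b) * 0ℤ + 0ℤ * a + 0ℤ * 0ℤ * D)
             + (c₄ * (b + c * D) * c + c₄ * (- c) * b + c₄ * (- c) * c * D) ≡ 0ℤ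
      l₂ = solve-∀

    -- y = ac/d stabilises Λ, so the conductor hypothesis gives ac ∣ y, which forces d = 1.
    cond2⇒cond1 : Cond2 Δ Λ → Cond1 Δ Λ
    cond2⇒cond1 (n , (_ , Ord⇔n∣) , idx) = from-gcd (bezout₄ (+ a * + c) (+ a * + a) (+ a * b) (Nm e₂))
      where
      from-gcd : ∃[ d ] (+ d ∣ + a * + c) × (+ d ∣ + a * + a) × (+ d ∣ + a * b) × (+ d ∣ Nm e₂) ×
                 ∃[ c₁ ] ∃[ c₂ ] ∃[ c₃ ] ∃[ c₄ ] + d ≡ c₁ * (+ a * + c) + c₂ * (+ a * + a) + c₃ * (+ a * b) + c₄ * Nm e₂ →
                 Cond1 Δ Λ
      from-gcd (d , divides y ac≡yd , d∣aa , d∣ab , d∣N , c₁ , c₂ , c₃ , c₄ , d≡comb) =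
        e₁ , e₂ , basis , combination⇒coprime c₁ c₂ c₃ c₄ (trans (cong +_ (sym d≡1)) d≡comb)
        where
        ac∣y : + a * + c ∣ y
        ac∣y = subst (_∣ y) (trans (cong +_ (index-unique {Λ} ∈-⊝ idx index)) (ℤP.pos-* a c))
          (∣ᵤ⇒∣ (Equivalence.to (Ord⇔n∣ (0ℤ , y))
            (stabilising⇒Ord 0ℤ y (cofactor-stabilising y d ac≡yd d∣aa d∣ab d∣N))))
        y≢0 : ℤ.NonZero y
        y≢0 = ℤ.≢-nonZero {y} λ y≡0 → ℕ.≢-nonZero⁻¹ (a ℕ.* c) {{ℕP.m*n≢0 a c}}
          (ℤP.+-injective (trans (ℤP.pos-* a c) (trans ac≡yd (cong (_* + d) y≡0))))
        d≡1 : d ≡ 1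
        d≡1 = ℕD.∣1⇒≡1 (∣⇒∣ᵤ (*-cancelˡ-∣ y {{y≢0}} (subst₂ _∣_ ac≡yd (sym (ℤP.*-identityʳ y)) ac∣y)))

  cond1⇔cond2 : ∀ {Λ} → IsLattice Δ Λ → Cond1 Δ Λ ⇔ Cond2 Δ Λ
  cond1⇔cond2 (β , δ , βδ-basis) = mk⇔ cond1⇒cond2 cond2⇒cond1
    where
    open HermiteForm (hermiteForm βδ-basis)
    open Triangular a c {{a≢0}} {{c≢0}} b basis

  ∣det∣≡index : ∀ {Λ β δ n} → IsBasis Δ Λ β δ → Index Δ Λ n → ∣ det β δ ∣ ≡ n
  ∣det∣≡index {Λ} βδ-basis idx =
    trans ∣det∣≡ac (index-unique {Λ} (Basis.∈-⊝ basis) (Triangular.index a c {{a≢0}} {{c≢0}} b basis) idx)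
    where open HermiteForm (hermiteForm βδ-basis)

  conj-det≡±index·√Δ : ∀ {Λ β δ n} → IsBasis Δ Λ β δ → Index Δ Λ n →
    ((conjK Δ β ⋆ δ) ⊝ (β ⋆ conjK Δ δ) ≡ (+ n) · sqrtΔ Δ) ⊎
    ((conjK Δ β ⋆ δ) ⊝ (β ⋆ conjK Δ δ) ≡ (- (+ n)) · sqrtΔ Δ)
  conj-det≡±index·√Δ {β = β} {δ} basis idx =
    Sum.map (λ e → trans (conj-det β δ) (cong (_· sqrtΔ Δ) (trans e (cong +_ ∣det∣≡n))))
            (λ e → trans (conj-det β δ) (cong (_· sqrtΔ Δ) (trans e (cong (λ m → - (+ m)) ∣det∣≡n))))
            (i≡±∣i∣ (det β δ))
    where ∣det∣≡n = ∣det∣≡index basis idx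

module Ideals (Δ : ℤ) where
  open RingOfIntegers Δ

  infix 4 _∣ᴷ_
  record _∣ᴷ_ (γ α : OK) : Set where
    constructor dividesᴷ
    field
      quotient : OK
      equality : α ≡ γ ⋆ quotient

  HasCoprimePair : (OK → Set) → Set
  HasCoprimePair Λ = ∃[ β ] ∃[ δ ] Λ β × Λ δ × Coprime Δ β δ

  coprime-∣ᴷ : ∀ {β δ γ α} → Coprime Δ β δ → γ ∣ᴷ α ⋆ β → γ ∣ᴷ α ⋆ δ → γ ∣ᴷ α
  coprime-∣ᴷ {β} {δ} {γ} {α} (X , Z , Xβ+Zδ≡1) (dividesᴷ κ₁ αβ≡γκ₁) (dividesᴷ κ₂ αδ≡γκ₂) =
    dividesᴷ ((X ⋆ κ₁) ⊕ (Z ⋆ κ₂)) (begin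
    α                                  ≡⟨ ⋆-identityʳ α ⟨
    α ⋆ oneK                           ≡⟨ cong (α ⋆_) Xβ+Zδ≡1 ⟨
    α ⋆ ((X ⋆ β) ⊕ (Z ⋆ δ))            ≡⟨ ⋆-distribˡ α (X ⋆ β) (Z ⋆ δ) ⟩
    (α ⋆ (X ⋆ β)) ⊕ (α ⋆ (Z ⋆ δ))      ≡⟨ cong₂ _⊕_ (⋆-swapˡ α X β) (⋆-swapˡ α Z δ) ⟩
    (X ⋆ (α ⋆ β)) ⊕ (Z ⋆ (α ⋆ δ))      ≡⟨ cong₂ (λ u v → (X ⋆ u) ⊕ (Z ⋆ v)) αβ≡γκ₁ αδ≡γκ₂ ⟩
    (X ⋆ (γ ⋆ κ₁)) ⊕ (Z ⋆ (γ ⋆ κ₂))    ≡⟨ cong₂ _⊕_ (⋆-swapˡ X γ κ₁) (⋆-swapˡ Z γ κ₂) ⟩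
    (γ ⋆ (X ⋆ κ₁)) ⊕ (γ ⋆ (Z ⋆ κ₂))    ≡⟨ ⋆-distribˡ γ (X ⋆ κ₁) (Z ⋆ κ₂) ⟨
    γ ⋆ ((X ⋆ κ₁) ⊕ (Z ⋆ κ₂))          ∎)
    where open ≡-Reasoning

  InProd-∣ᴷ : ∀ {A B γ z} → (∀ a → A a → γ ∣ᴷ a) → InProd Δ A B z → γ ∣ᴷ z
  InProd-∣ᴷ {A} {B} {γ} A⊆γ (k , as , bs , as∈ , _ , refl) = sum-∣ᴷ k as bs (λ i → A⊆γ (as i) (as∈ i))
    where
    sum-∣ᴷ : ∀ k (as bs : Fin k → OK) → (∀ i → γ ∣ᴷ as i) → γ ∣ᴷ sumK Δ k (λ i → as i ⋆ bs i)
    sum-∣ᴷ zero    as bs _ = dividesᴷ zeroK (sym (⋆-zeroʳ γ))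
    sum-∣ᴷ (suc k) as bs γ∣as =
      let dividesᴷ κ a₀≡γκ = γ∣as zero
          dividesᴷ κ′ rest≡γκ′ = sum-∣ᴷ k (λ i → as (suc i)) (λ i → bs (suc i)) (λ i → γ∣as (suc i))
      in dividesᴷ ((κ ⋆ bs zero) ⊕ κ′) (
         trans (cong₂ _⊕_ (trans (cong (_⋆ bs zero) a₀≡γκ) (⋆-assoc γ κ (bs zero))) rest≡γκ′)
               (sym (⋆-distribˡ γ (κ ⋆ bs zero) κ′)))

  ⋆-accumulate : ∀ β δ m n b X Y →
    (((m · β) ⊕ (n · δ)) ⋆ b) ⊕ ((X ⋆ β) ⊕ (Y ⋆ δ)) ≡ (((m · b) ⊕ X) ⋆ β) ⊕ (((n · b) ⊕ Y) ⋆ δ)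
  ⋆-accumulate β δ m n b X Y = begin
    (((m · β) ⊕ (n · δ)) ⋆ b) ⊕ ((X ⋆ β) ⊕ (Y ⋆ δ))
      ≡⟨ cong (_⊕ ((X ⋆ β) ⊕ (Y ⋆ δ))) (⋆-distribʳ b (m · β) (n · δ)) ⟩
    (((m · β) ⋆ b) ⊕ ((n · δ) ⋆ b)) ⊕ ((X ⋆ β) ⊕ (Y ⋆ δ))
      ≡⟨ cong (λ u → (u ⊕ ((n · δ) ⋆ b)) ⊕ ((X ⋆ β) ⊕ (Y ⋆ δ))) (·-⋆-comm m β b) ⟩
    (((m · b) ⋆ β) ⊕ ((n · δ) ⋆ b)) ⊕ ((X ⋆ β) ⊕ (Y ⋆ δ))
      ≡⟨ cong (λ u → (((m · b) ⋆ β) ⊕ u) ⊕ ((X ⋆ β) ⊕ (Y ⋆ δ))) (·-⋆-comm n δ b) ⟩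
    (((m · b) ⋆ β) ⊕ ((n · b) ⋆ δ)) ⊕ ((X ⋆ β) ⊕ (Y ⋆ δ))
      ≡⟨ ⊕-interchange ((m · b) ⋆ β) ((n · b) ⋆ δ) (X ⋆ β) (Y ⋆ δ) ⟩
    (((m · b) ⋆ β) ⊕ (X ⋆ β)) ⊕ (((n · b) ⋆ δ) ⊕ (Y ⋆ δ))
      ≡⟨ cong₂ _⊕_ (⋆-distribʳ β (m · b) X) (⋆-distribʳ δ (n · b) Y) ⟨
    (((m · b) ⊕ X) ⋆ β) ⊕ (((n · b) ⊕ Y) ⋆ δ)
      ∎
    where open ≡-Reasoning

  InProd-span : ∀ {A B β δ z} → (∀ a → A a → Span β δ a) → InProd Δ A B z → ∃[ X ] ∃[ Y ] z ≡ (X ⋆ β) ⊕ (Y ⋆ δ)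
  InProd-span {A} {B} {β} {δ} A⊆span (k , as , bs , as∈ , _ , refl) = sum-span k as bs (λ i → A⊆span (as i) (as∈ i))
    where
    sum-span : ∀ k (as bs : Fin k → OK) → (∀ i → Span β δ (as i)) →
               ∃[ X ] ∃[ Y ] sumK Δ k (λ i → as i ⋆ bs i) ≡ (X ⋆ β) ⊕ (Y ⋆ δ)
    sum-span zero as bs _ = zeroK , zeroK , sym (trans (cong₂ _⊕_ (⋆-comm zeroK β) (⋆-comm zeroK δ))
                                                 (cong₂ _⊕_ (⋆-zeroʳ β) (⋆-zeroʳ δ)))
    sum-span (suc k) as bs spans =
      let (m , n , a₀≡) = spans zero
          (X , Y , rest≡) = sum-span k (λ i → as (suc i)) (λ i → bs (suc i)) (λ i → spans (suc i))
      in (m · bs zero) ⊕ X , (n · bs zero) ⊕ Y ,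
         trans (cong₂ (λ a r → (a ⋆ bs zero) ⊕ r) a₀≡ rest≡) (⋆-accumulate β δ m n (bs zero) X Y)

module Representatives (Δ : ℤ) (disc : ImagQuadDisc Δ) where
  open RingOfIntegers Δ
  open Lattices Δ
  open Ideals Δ

  private
    cancel : ∀ γ {x y} → ¬ γ ≡ zeroK → γ ⋆ x ≡ γ ⋆ y → x ≡ y
    cancel = ⋆-cancelˡ disc

  cond1⇒coprime-pair : ∀ {Λ} → Cond1 Δ Λ → HasCoprimePair Λ
  cond1⇒coprime-pair (β , δ , basis , coprime) = β , δ , Basis.β∈ basis , Basis.δ∈ basis , coprime

  ⋆-factor : ∀ α′ γ {α} → α ≡ α′ ⋆ γ → ∀ l → α ⋆ l ≡ α′ ⋆ (γ ⋆ l)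
  ⋆-factor α′ γ refl l = ⋆-assoc α′ γ l

  sameClass⇒scaled : ∀ {Λ A} → HasCoprimePair Λ → SameClass Δ Λ A → ∃[ γ ] ¬ γ ≡ zeroK × A ≐ Scaled Δ γ Λ
  sameClass⇒scaled {Λ} {A} (β , δ , β∈ , δ∈ , coprime) (α , α′ , α≢0 , α′≢0 , αΛ≐α′A) =
    γ , γ≢0 , λ x → mk⇔ (to x) (from x)
    where
    α′∣α⋆ : ∀ {l} → Λ l → α′ ∣ᴷ α ⋆ l
    α′∣α⋆ {l} l∈ = let (a , _ , αl≡α′a) = Equivalence.to (αΛ≐α′A (α ⋆ l)) (l , l∈ , refl) in dividesᴷ a αl≡α′a
    α′∣α : α′ ∣ᴷ α
    α′∣α = coprime-∣ᴷ coprime (α′∣α⋆ β∈) (α′∣α⋆ δ∈)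
    γ : OK
    γ = _∣ᴷ_.quotient α′∣α
    α≡α′γ : α ≡ α′ ⋆ γ
    α≡α′γ = _∣ᴷ_.equality α′∣α
    γ≢0 : ¬ γ ≡ zeroK
    γ≢0 γ≡0 = α≢0 (trans α≡α′γ (trans (cong (α′ ⋆_) γ≡0) (⋆-zeroʳ α′)))
    to : ∀ x → A x → Scaled Δ γ Λ x
    to x x∈ =
      let (l , l∈ , α′x≡αl) = Equivalence.from (αΛ≐α′A (α′ ⋆ x)) (x , x∈ , refl)
      in l , l∈ , cancel α′ α′≢0 (trans α′x≡αl (⋆-factor α′ γ α≡α′γ l))
    from : ∀ x → Scaled Δ γ Λ x → A x
    from x (l , l∈ , x≡γl) =
      let (a , a∈ , αl≡α′a) = Equivalence.to (αΛ≐α′A (α ⋆ l)) (l , l∈ , refl)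
      in subst A (sym (trans x≡γl (cancel α′ α′≢0 (trans (sym (⋆-factor α′ γ α≡α′γ l)) αl≡α′a)))) a∈

  scaled⇒inKer : ∀ {Λ A γ} → HasCoprimePair Λ → ¬ γ ≡ zeroK → A ≐ Scaled Δ γ Λ → InKer Δ A
  scaled⇒inKer {Λ} {A} {γ} (β , δ , β∈ , δ∈ , (X , Z , Xβ+Zδ≡1)) γ≢0 A≐γΛ = γ , γ≢0 , λ x → mk⇔ (to x) (from x)
    where
    to : ∀ x → InProd Δ A (λ _ → ⊤) x → Scaled Δ γ (λ _ → ⊤) x
    to x x∈ = let dividesᴷ κ x≡γκ = InProd-∣ᴷ A⊆γ x∈ in κ , tt , x≡γκ
      where
      A⊆γ : ∀ a → A a → γ ∣ᴷ a
      A⊆γ a a∈ = let (l , _ , a≡γl) = Equivalence.to (A≐γΛ a) a∈ in dividesᴷ l a≡γl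
    γ⋆∈ : ∀ {l} → Λ l → A (γ ⋆ l)
    γ⋆∈ {l} l∈ = Equivalence.from (A≐γΛ (γ ⋆ l)) (l , l∈ , refl)
    from : ∀ x → Scaled Δ γ (λ _ → ⊤) x → InProd Δ A (λ _ → ⊤) x
    from x (w , _ , x≡γw) = 2 , gens , coeffs , gens∈ , (λ _ → tt) , trans x≡γw γw≡
      where
      gens coeffs : Fin 2 → OK
      gens zero    = γ ⋆ β
      gens (suc _) = γ ⋆ δ
      coeffs zero    = X ⋆ w
      coeffs (suc _) = Z ⋆ w
      gens∈ : ∀ i → A (gens i)
      gens∈ zero    = γ⋆∈ β∈
      gens∈ (suc _) = γ⋆∈ δ∈
      γw≡ : γ ⋆ w ≡ sumK Δ 2 (λ i → gens i ⋆ coeffs i)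
      γw≡ = begin
        γ ⋆ w                                              ≡⟨ ⋆-identityʳ (γ ⋆ w) ⟨
        (γ ⋆ w) ⋆ oneK                                     ≡⟨ cong ((γ ⋆ w) ⋆_) Xβ+Zδ≡1 ⟨
        (γ ⋆ w) ⋆ ((X ⋆ β) ⊕ (Z ⋆ δ))                      ≡⟨ ⋆-distribˡ (γ ⋆ w) (X ⋆ β) (Z ⋆ δ) ⟩
        ((γ ⋆ w) ⋆ (X ⋆ β)) ⊕ ((γ ⋆ w) ⋆ (Z ⋆ δ))          ≡⟨ cong₂ _⊕_ (⋆-interchange γ w X β) (⋆-interchange γ w Z δ) ⟩
        ((γ ⋆ β) ⋆ (X ⋆ w)) ⊕ ((γ ⋆ δ) ⋆ (Z ⋆ w))          ≡⟨ cong (((γ ⋆ β) ⋆ (X ⋆ w)) ⊕_) (⊕-zeroʳ _) ⟨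
        ((γ ⋆ β) ⋆ (X ⋆ w)) ⊕ (((γ ⋆ δ) ⋆ (Z ⋆ w)) ⊕ zeroK) ∎
        where open ≡-Reasoning

  scaled-unique : ∀ {A Λ Λ′ γ γ′} → HasCoprimePair Λ → HasCoprimePair Λ′ → ¬ γ ≡ zeroK → ¬ γ′ ≡ zeroK →
                  A ≐ Scaled Δ γ Λ → A ≐ Scaled Δ γ′ Λ′ → ∃[ u ] IsUnit Δ u × Λ′ ≐ Scaled Δ u Λ
  scaled-unique {A} {Λ} {Λ′} {γ} {γ′} pair pair′ γ≢0 γ′≢0 A≐γΛ A≐γ′Λ′ =
    v , (u , v⋆u≡1) , λ x → mk⇔ (to x) (from x)
    where
    scale-∣ᴷ : ∀ {Λ Λ′ γ γ′} → HasCoprimePair Λ → A ≐ Scaled Δ γ Λ → A ≐ Scaled Δ γ′ Λ′ → γ′ ∣ᴷ γ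
    scale-∣ᴷ {Λ} {Λ′} {γ} {γ′} (β , δ , β∈ , δ∈ , coprime) A≐γΛ A≐γ′Λ′ = coprime-∣ᴷ coprime (γ′∣γ⋆ β∈) (γ′∣γ⋆ δ∈)
      where
      γ′∣γ⋆ : ∀ {l} → Λ l → γ′ ∣ᴷ γ ⋆ l
      γ′∣γ⋆ {l} l∈ =
        let (l′ , _ , γl≡γ′l′) = Equivalence.to (A≐γ′Λ′ (γ ⋆ l)) (Equivalence.from (A≐γΛ (γ ⋆ l)) (l , l∈ , refl))
        in dividesᴷ l′ γl≡γ′l′
    open _∣ᴷ_ (scale-∣ᴷ {Λ} {Λ′} {γ} {γ′} pair A≐γΛ A≐γ′Λ′) renaming (quotient to v; equality to γ≡γ′v)
    open _∣ᴷ_ (scale-∣ᴷ {Λ′} {Λ} {γ′} {γ} pair′ A≐γ′Λ′ A≐γΛ) renaming (quotient to u; equality to γ′≡γu)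
    v⋆u≡1 : v ⋆ u ≡ oneK
    v⋆u≡1 = sym (cancel γ γ≢0 (begin
      γ ⋆ oneK         ≡⟨ ⋆-identityʳ γ ⟩
      γ                ≡⟨ γ≡γ′v ⟩
      γ′ ⋆ v           ≡⟨ ⋆-factor γ u γ′≡γu v ⟩
      γ ⋆ (u ⋆ v)      ≡⟨ cong (γ ⋆_) (⋆-comm u v) ⟩
      γ ⋆ (v ⋆ u)      ∎))
      where open ≡-Reasoning
    to : ∀ x → Λ′ x → Scaled Δ v Λ x
    to x x∈ =
      let (l , l∈ , γ′x≡γl) = Equivalence.to (A≐γΛ (γ′ ⋆ x)) (Equivalence.from (A≐γ′Λ′ (γ′ ⋆ x)) (x , x∈ , refl))
      in l , l∈ , cancel γ′ γ′≢0 (trans γ′x≡γl (⋆-factor γ′ v γ≡γ′v l))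
    from : ∀ x → Scaled Δ v Λ x → Λ′ x
    from x (l , l∈ , x≡vl) =
      let (l′ , l′∈ , γl≡γ′l′) = Equivalence.to (A≐γ′Λ′ (γ ⋆ l)) (Equivalence.from (A≐γΛ (γ ⋆ l)) (l , l∈ , refl))
      in subst Λ′ (sym (trans x≡vl (cancel γ′ γ′≢0 (trans (sym (⋆-factor γ′ v γ≡γ′v l)) γl≡γ′l′)))) l′∈

  divide-basis : ∀ {A γ β δ} → ¬ γ ≡ zeroK → IsBasis Δ A (γ ⋆ β) (γ ⋆ δ) → IsBasis Δ (λ x → A (γ ⋆ x)) β δ
  divide-basis {A} {γ} {β} {δ} γ≢0 (independent , A≐span) = independent′ , λ x → mk⇔ (to x) (from x)
    where
    γ⋆lincomb : ∀ m n → γ ⋆ ((m · β) ⊕ (n · δ)) ≡ (m · (γ ⋆ β)) ⊕ (n · (γ ⋆ δ))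
    γ⋆lincomb m n = ⋆-lincomb γ m β n δ
    independent′ : LinearlyIndependent β δ
    independent′ m n eq = independent m n (trans (sym (γ⋆lincomb m n)) (trans (cong (γ ⋆_) eq) (⋆-zeroʳ γ)))
    to : ∀ x → A (γ ⋆ x) → Span β δ x
    to x γx∈ = let (m , n , eq) = Equivalence.to (A≐span (γ ⋆ x)) γx∈
               in m , n , cancel γ γ≢0 (trans eq (sym (γ⋆lincomb m n)))
    from : ∀ x → Span β δ x → A (γ ⋆ x)
    from x (m , n , x≡) = Equivalence.from (A≐span (γ ⋆ x)) (m , n , trans (cong (γ ⋆_) x≡) (γ⋆lincomb m n))

  -- Λ = γ⁻¹A lies in O_K because A ⊆ A O_K = γ O_K.
  inKer⇒representative : ∀ {f A} → InvIdeal Δ f A → InKer Δ A → ∃[ Λ ] RepLattice Δ f A Λ × Cond1 Δ Λ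
  inKer⇒representative {f} {A} ((βA , δA , basisA) , A-module , _) (γ , γ≢0 , AOK≐γOK) =
    Λ , ((β , δ , basis) , Λ-module , sameClass) , (β , δ , basis , coprime)
    where
    Λ : OK → Set
    Λ x = A (γ ⋆ x)
    A⊆γ : ∀ {a} → A a → γ ∣ᴷ a
    A⊆γ {a} a∈ =
      let (κ , _ , a≡γκ) = Equivalence.to (AOK≐γOK a)
            (1 , (λ _ → a) , (λ _ → oneK) , (λ _ → a∈) , (λ _ → tt) ,
             sym (trans (⊕-zeroʳ (a ⋆ oneK)) (⋆-identityʳ a)))
      in dividesᴷ κ a≡γκ
    open _∣ᴷ_ (A⊆γ (Basis.β∈ basisA)) renaming (quotient to β; equality to βA≡γβ)
    open _∣ᴷ_ (A⊆γ (Basis.δ∈ basisA)) renaming (quotient to δ; equality to δA≡γδ)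
    basis : IsBasis Δ Λ β δ
    basis = divide-basis γ≢0 (subst₂ (IsBasis Δ A) βA≡γβ δA≡γδ basisA)
    Λ-module : IsOfModule Δ f Λ
    Λ-module α x α∈ x∈ = subst A (⋆-swapˡ α γ x) (A-module α (γ ⋆ x) α∈ x∈)
    sameClass : SameClass Δ Λ A
    sameClass = γ , oneK , γ≢0 , (λ ()) , λ x → mk⇔
      (λ (y , y∈ , x≡γy) → γ ⋆ y , y∈ , trans x≡γy (sym (⋆-identityˡ (γ ⋆ y))))
      (λ (a , a∈ , x≡1a) → let dividesᴷ κ a≡γκ = A⊆γ a∈
                           in κ , subst A a≡γκ a∈ , trans x≡1a (trans (⋆-identityˡ a) a≡γκ))
    coprime : Coprime Δ β δ
    coprime =
      let (X , Y , γ≡XβA+YδA) = InProd-span (λ a a∈ → Basis.toSpan basisA a∈)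
                                  (Equivalence.from (AOK≐γOK γ) (oneK , tt , sym (⋆-identityʳ γ)))
      in X , Y , sym (cancel γ γ≢0 (begin
        γ ⋆ oneK                         ≡⟨ ⋆-identityʳ γ ⟩
        γ                                ≡⟨ γ≡XβA+YδA ⟩
        (X ⋆ βA) ⊕ (Y ⋆ δA)              ≡⟨ cong₂ (λ u v → (X ⋆ u) ⊕ (Y ⋆ v)) βA≡γβ δA≡γδ ⟩
        (X ⋆ (γ ⋆ β)) ⊕ (Y ⋆ (γ ⋆ δ))    ≡⟨ cong₂ _⊕_ (⋆-swapˡ X γ β) (⋆-swapˡ Y γ δ) ⟩
        (γ ⋆ (X ⋆ β)) ⊕ (γ ⋆ (Y ⋆ δ))    ≡⟨ ⋆-distribˡ γ (X ⋆ β) (Y ⋆ δ) ⟨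
        γ ⋆ ((X ⋆ β) ⊕ (Y ⋆ δ))          ∎))
      where open ≡-Reasoning

proposition5p1 : (Δ : ℤ) → ImagQuadDisc Δ →
    ((Λ : OK → Set) → IsLattice Δ Λ → (Cond1 Δ Λ ⇔ Cond2 Δ Λ)) ×
    ((f : ℕ) → 1 ≤ f → (A : OK → Set) → InvIdeal Δ f A →
      (InKer Δ A ⇔ (∃[ Λ ] RepLattice Δ f A Λ × Cond1 Δ Λ × Cond2 Δ Λ)) ×
      ((Λ Λ′ : OK → Set) →
        RepLattice Δ f A Λ → Cond1 Δ Λ × Cond2 Δ Λ →
        RepLattice Δ f A Λ′ → Cond1 Δ Λ′ × Cond2 Δ Λ′ →
        ∃[ u ] IsUnit Δ u × (∀ x → Λ′ x ⇔ Scaled Δ u Λ x))) ×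
    ((Λ : OK → Set) (β δ : OK) (n : ℕ) → IsBasis Δ Λ β δ → Index Δ Λ n →
      (mulK Δ (conjK Δ β) δ ⊝ mulK Δ β (conjK Δ δ) ≡ (+ n) · sqrtΔ Δ) ⊎
      (mulK Δ (conjK Δ β) δ ⊝ mulK Δ β (conjK Δ δ) ≡ (- (+ n)) · sqrtΔ Δ))
proposition5p1 Δ disc =
  (λ Λ → cond1⇔cond2) ,
  (λ f _ A A-invertible → mk⇔ (inKer⇒rep A-invertible) rep⇒inKer , unique) ,
  (λ Λ β δ n → conj-det≡±index·√Δ)
  where
  open Lattices Δ
  open Ideals Δ
  open Representatives Δ disc
  inKer⇒rep : ∀ {f A} → InvIdeal Δ f A → InKer Δ A → ∃[ Λ ] RepLattice Δ f A Λ × Cond1 Δ Λ × Cond2 Δ Λ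
  inKer⇒rep A-invertible inKer =
    let (Λ , rep , cond1) = inKer⇒representative A-invertible inKer
    in Λ , rep , cond1 , Equivalence.to (cond1⇔cond2 (proj₁ rep)) cond1
  rep⇒inKer : ∀ {f A} → (∃[ Λ ] RepLattice Δ f A Λ × Cond1 Δ Λ × Cond2 Δ Λ) → InKer Δ A
  rep⇒inKer (Λ , (_ , _ , sameClass) , cond1 , _) =
    let (γ , γ≢0 , A≐γΛ) = sameClass⇒scaled (cond1⇒coprime-pair cond1) sameClass
    in scaled⇒inKer (cond1⇒coprime-pair cond1) γ≢0 A≐γΛ
  unique : ∀ {f A} (Λ Λ′ : OK → Set) → RepLattice Δ f A Λ → Cond1 Δ Λ × Cond2 Δ Λ →
           RepLattice Δ f A Λ′ → Cond1 Δ Λ′ × Cond2 Δ Λ′ → ∃[ u ] IsUnit Δ u × Λ′ ≐ Scaled Δ u Λ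
  unique Λ Λ′ (_ , _ , sameClass) (cond1 , _) (_ , _ , sameClass′) (cond1′ , _) =
    let (γ , γ≢0 , A≐γΛ) = sameClass⇒scaled (cond1⇒coprime-pair cond1) sameClass
        (γ′ , γ′≢0 , A≐γ′Λ′) = sameClass⇒scaled (cond1⇒coprime-pair cond1′) sameClass′
    in scaled-unique (cond1⇒coprime-pair cond1) (cond1⇒coprime-pair cond1′) γ≢0 γ′≢0 A≐γΛ A≐γ′Λ′
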